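{- Let $F(z)=\sum_{n\ge 0} I_n z^n$, where $I_n$ is the number of inversion sequences of length $n$ avoiding each of the patterns $102$, $201$ and $210$ (equivalently, with no indices $i<j<k$ such that $a_i>a_j$, $a_j\ne a_k$ and $a_i\ne a_k$), with $I_0=1$. Then \[ F(z)=\frac{2-15z+32z^2-16z^3+z(1-2z)(1+2z)\sqrt{1-4z}}{2(1-z)^2(1-2z)(1-4z)}. \]
   Context: An inversion sequence of length $n$ is an integer sequence $(a_1,\dots,a_n)$ with $0\le a_i<i$ for all $i$. A pattern is a sequence of non-negative integers containing every value from $0$ to its maximum. The reduction of a sequence of non-negative integers replaces its smallest entries by $0$, the next smallest by $1$, and so on. A sequence $a$ contains a pattern $\sigma$ of length $k$ if some (not necessarily consecutive) subsequence $a_{i_1}\cdots a_{i_k}$, $i_1<\dots<i_k$, has reduction $\sigma$; otherwise it avoids $\sigma$. The empty sequence is the unique inversion sequence of length $0$. -}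

module Defs where

open import Data.Nat using (ℕ; zero; suc; _<?_; _∸_)
import Data.Nat as ℕ
open import Data.Integer using (ℤ; +_; -[1+_]; _+_; _*_)
open import Data.List using (List; []; _∷_; _++_; map; concatMap; upTo; length; filter; foldr; deduplicate; [_])
open import Data.List.Properties using (≡-dec)
open import Data.List.Relation.Unary.Any using (Any; any?)
open import Data.List.Relation.Unary.All using (All; all?)
open import Relation.Binary.PropositionalEquality using (_≡_)
open import Relation.Nullary using (¬_; ¬?)
open import Relation.Unary using (Decidable)

-- All inversion sequences of length n, as lists (a₁,…,aₙ) with 0 ≤ aᵢ < i.
-- Each one appears exactly once.
invSeqs : ℕ → List (List ℕ)
invSeqs zero    = [] ∷ []
invSeqs (suc n) = concatMap (λ s → map (λ a → s ++ [ a ]) (upTo (suc n))) (invSeqs n)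

rank : List ℕ → ℕ → ℕ
rank s x = length (filter (_<? x) (deduplicate ℕ._≟_ s))

reduce : List ℕ → List ℕ
reduce s = map (rank s) s

subseqs : {A : Set} → List A → List (List A)
subseqs []       = [] ∷ []
subseqs (x ∷ xs) = subseqs xs ++ map (x ∷_) (subseqs xs)

Contains : List ℕ → List ℕ → Set
Contains σ a = Any (λ t → reduce t ≡ σ) (subseqs a)

contains? : (σ : List ℕ) → Decidable (Contains σ)
contains? σ a = any? (λ t → ≡-dec ℕ._≟_ (reduce t) σ) (subseqs a)

patterns : List (List ℕ)
patterns = (1 ∷ 0 ∷ 2 ∷ []) ∷ (2 ∷ 0 ∷ 1 ∷ []) ∷ (2 ∷ 1 ∷ 0 ∷ []) ∷ []

AvoidsAll : List ℕ → Set
AvoidsAll a = All (λ σ → ¬ Contains σ a) patterns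

avoidsAll? : Decidable AvoidsAll
avoidsAll? a = all? (λ σ → ¬? (contains? σ a)) patterns

I : ℕ → ℕ
I n = length (filter avoidsAll? (invSeqs n))

Series : Set
Series = ℕ → ℤ

_⊛_ : Series → Series → Series
(f ⊛ g) n = foldr _+_ (+ 0) (map (λ i → f i * g (n ∸ i)) (upTo (suc n)))

_⊕_ : Series → Series → Series
(f ⊕ g) n = f n + g n

poly : List ℤ → Series
poly []       n       = + 0
poly (c ∷ cs) zero    = c
poly (c ∷ cs) (suc n) = poly cs n

F : Series
F n = + (I n)

denom : Series
denom = poly (+ 2 ∷ []) ⊛ (poly (+ 1 ∷ -[1+ 0 ] ∷ []) ⊛ (poly (+ 1 ∷ -[1+ 0 ] ∷ [])
          ⊛ (poly (+ 1 ∷ -[1+ 1 ] ∷ []) ⊛ poly (+ 1 ∷ -[1+ 3 ] ∷ []))))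

numPoly : Series
numPoly = poly (+ 2 ∷ -[1+ 14 ] ∷ + 32 ∷ -[1+ 15 ] ∷ [])

sqrtCoeff : Series
sqrtCoeff = poly (+ 0 ∷ + 1 ∷ []) ⊛ (poly (+ 1 ∷ -[1+ 1 ] ∷ []) ⊛ poly (+ 1 ∷ + 2 ∷ []))

oneMinus4z : Series
oneMinus4z = poly (+ 1 ∷ -[1+ 3 ] ∷ [])

{-# OPTIONS --safe #-}

-- Read from left to right, this is decided by a four-state automaton: while
-- the sequence is weakly increasing it remembers its maximum M and the largest smaller entry m;
-- a first descent from M to some x ≥ m leaves M and x as the only allowed later entries; a
-- descent to some x < m (below two distinct larger entries) leaves only x; anything else is fatal.
-- Extending each inversion sequence of length n by its n + 1 possible last entries gives linear
-- recurrences for the number of sequences in each state, driven by moments of the weakly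
-- increasing ones.  These are counted by the Catalan numbers Aₙ (ballot formula), so
-- S = 1 − 2 ∑ Aₙ zⁿ⁺¹ = √(1 − 4z), and eliminating the auxiliary sequences leaves a
-- fourth-order recurrence for Iₙ which is the stated identity for F.

module Submission where

open import Defs
open import Data.Nat.Base using (ℕ; zero; suc)
open import Data.List.Base using (List; []; _∷_; _∷ʳ_; [_]; map)
open import Data.Product.Base using (Σ; ∃-syntax; _×_; _,_; proj₁; proj₂)
open import Data.Sum.Base using (_⊎_; inj₁; inj₂)
open import Data.Empty using (⊥; ⊥-elim)
open import Relation.Nullary using (¬_; yes; no; does; Dec)
open import Relation.Binary.PropositionalEquality
  using (_≡_; _≢_; ≢-sym; refl; sym; trans; cong; cong₂; subst; subst₂; module ≡-Reasoning)

module Subsequences {A : Set} where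
  open import Data.List.Membership.Propositional using (_∈_)
  open import Data.List.Membership.Propositional.Properties using (∈-++⁻; ∈-++⁺ˡ; ∈-++⁺ʳ; ∈-map⁻; ∈-map⁺)
  open import Data.List.Properties using (∷ʳ-injective)
  open import Data.List.Relation.Unary.Any using (here; there)

  infix 4 _⊑_

  _⊑_ : List A → List A → Set
  t ⊑ s = t ∈ subseqs s

  []⊑ : ∀ s → [] ⊑ s
  []⊑ []      = here refl
  []⊑ (x ∷ s) = ∈-++⁺ˡ ([]⊑ s)

  ⊑-∷ʳ⁻ : ∀ s {a t} → t ⊑ s ∷ʳ a → t ⊑ s ⊎ ∃[ t′ ] (t ≡ t′ ∷ʳ a × t′ ⊑ s)
  ⊑-∷ʳ⁻ [] (here refl)         = inj₁ (here refl)
  ⊑-∷ʳ⁻ [] (there (here refl)) = inj₂ ([] , refl , here refl)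
  ⊑-∷ʳ⁻ (x ∷ s) {a} p with ∈-++⁻ (subseqs (s ∷ʳ a)) p
  ... | inj₁ q with ⊑-∷ʳ⁻ s q
  ...   | inj₁ r              = inj₁ (∈-++⁺ˡ r)
  ...   | inj₂ (t′ , eq , r)  = inj₂ (t′ , eq , ∈-++⁺ˡ r)
  ⊑-∷ʳ⁻ (x ∷ s) p | inj₂ q with ∈-map⁻ (x ∷_) q
  ... | u , u⊑ , refl with ⊑-∷ʳ⁻ s u⊑
  ...   | inj₁ r                = inj₁ (∈-++⁺ʳ (subseqs s) (∈-map⁺ (x ∷_) r))
  ...   | inj₂ (t′ , refl , r)  = inj₂ (x ∷ t′ , refl , ∈-++⁺ʳ (subseqs s) (∈-map⁺ (x ∷_) r))

  ⊑-∷ʳ : ∀ s {a t} → t ⊑ s → t ⊑ s ∷ʳ a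
  ⊑-∷ʳ [] (here refl) = here refl
  ⊑-∷ʳ (x ∷ s) {a} p with ∈-++⁻ (subseqs s) p
  ... | inj₁ q = ∈-++⁺ˡ (⊑-∷ʳ s q)
  ... | inj₂ q with ∈-map⁻ (x ∷_) q
  ...   | u , u⊑ , refl = ∈-++⁺ʳ (subseqs (s ∷ʳ a)) (∈-map⁺ (x ∷_) (⊑-∷ʳ s u⊑))

  ∷ʳ-⊑-∷ʳ : ∀ s {a t} → t ⊑ s → t ∷ʳ a ⊑ s ∷ʳ a
  ∷ʳ-⊑-∷ʳ [] (here refl) = there (here refl)
  ∷ʳ-⊑-∷ʳ (x ∷ s) {a} p with ∈-++⁻ (subseqs s) p
  ... | inj₁ q = ∈-++⁺ˡ (∷ʳ-⊑-∷ʳ s q)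
  ... | inj₂ q with ∈-map⁻ (x ∷_) q
  ...   | u , u⊑ , refl = ∈-++⁺ʳ (subseqs (s ∷ʳ a)) (∈-map⁺ (x ∷_) (∷ʳ-⊑-∷ʳ s u⊑))

  ∷ʳ-⊑-∷ʳ⁻ : ∀ s t {a w} → t ∷ʳ w ⊑ s ∷ʳ a → t ∷ʳ w ⊑ s ⊎ (w ≡ a × t ⊑ s)
  ∷ʳ-⊑-∷ʳ⁻ s t p with ⊑-∷ʳ⁻ s p
  ... | inj₁ q = inj₁ q
  ... | inj₂ (t′ , eq , q) with ∷ʳ-injective t t′ eq
  ...   | refl , refl = inj₂ (refl , q)

open Subsequences

module InversionSequences where
  open import Data.Nat.Base using (_<_)
  open import Data.List.Base using (upTo)
  open import Data.List.Membership.Propositional using (_∈_; find)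
  open import Data.List.Membership.Propositional.Properties using (∈-concatMap⁻; ∈-map⁻; ∈-upTo⁻)

  invSeqs-∷ʳ⁻ : ∀ {n s} → s ∈ invSeqs (suc n) → ∃[ s′ ] ∃[ a ] (s ≡ s′ ∷ʳ a × s′ ∈ invSeqs n × a < suc n)
  invSeqs-∷ʳ⁻ {n} p with find (∈-concatMap⁻ (λ s′ → map (s′ ∷ʳ_) (upTo (suc n))) {xs = invSeqs n} p)
  ... | s′ , s′∈ , q with ∈-map⁻ (s′ ∷ʳ_) q
  ...   | a , a∈ , refl = s′ , a , refl , s′∈ , ∈-upTo⁻ a∈

module Patterns where
  open import Data.Nat.Base using (_<_; _≤_; z≤n; s≤s)
  open import Data.Nat.Properties
    using (_≟_; _<?_; <-cmp; ≰⇒>; n≮n; <-trans; ≤-trans; <-asym; >⇒≢; <⇒≢)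
  open import Data.List.Base using (length; filter; deduplicate)
  open import Data.List.Properties using (∷-injective)
  open import Data.List.Membership.Propositional using (find; lose)
  open import Data.List.Relation.Unary.All using (_∷_; [])
  open import Data.List.Relation.Binary.Sublist.Propositional using (⊆-refl)
  open import Data.List.Relation.Binary.Sublist.Propositional.Properties using (filter⁺; length-mono-≤)
  open import Relation.Binary.Definitions using (tri<; tri≈; tri>)
  open import Relation.Nullary.Decidable using (dec-true; dec-false)

  Forbidden : List ℕ → Set
  Forbidden s = ∃[ u ] ∃[ v ] ∃[ w ] (u ∷ v ∷ [ w ] ⊑ s × v < u × w ≢ u × w ≢ v)

  forbidden-∷ʳ⁻ : ∀ s {a} → Forbidden (s ∷ʳ a) →
                  Forbidden s ⊎ ∃[ u ] ∃[ v ] (u ∷ [ v ] ⊑ s × v < u × a ≢ u × a ≢ v)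
  forbidden-∷ʳ⁻ s (u , v , w , p , v<u , w≢u , w≢v) with ∷ʳ-⊑-∷ʳ⁻ s (u ∷ [ v ]) p
  ... | inj₁ q          = inj₁ (u , v , w , q , v<u , w≢u , w≢v)
  ... | inj₂ (refl , q) = inj₂ (u , v , q , v<u , w≢u , w≢v)

  forbidden-∷ʳ : ∀ s {a} → Forbidden s → Forbidden (s ∷ʳ a)
  forbidden-∷ʳ s (u , v , w , p , rest) = u , v , w , ⊑-∷ʳ s p , rest

  forbidden-completed : ∀ s {a u v} → u ∷ [ v ] ⊑ s → v < u → a ≢ u → a ≢ v → Forbidden (s ∷ʳ a)
  forbidden-completed s {a} {u} {v} p v<u a≢u a≢v = u , v , a , ∷ʳ-⊑-∷ʳ s p , v<u , a≢u , a≢v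

  ¬forbidden-∷ʳ : ∀ s {a} → ¬ Forbidden s →
                  (∀ u v → u ∷ [ v ] ⊑ s → v < u → a ≡ u ⊎ a ≡ v) → ¬ Forbidden (s ∷ʳ a)
  ¬forbidden-∷ʳ s ok hits f with forbidden-∷ʳ⁻ s f
  ... | inj₁ f′ = ok f′
  ... | inj₂ (u , v , p , v<u , a≢u , a≢v) with hits u v p v<u
  ...   | inj₁ a≡u = a≢u a≡u
  ...   | inj₂ a≡v = a≢v a≡v

  rank-mono : ∀ t {x y} → x ≤ y → rank t x ≤ rank t y
  rank-mono t {x} {y} x≤y =
    length-mono-≤ (filter⁺ (_<? x) (_<? y) (λ { refl z<x → ≤-trans z<x x≤y }) (⊆-refl {x = deduplicate _≟_ t}))

  rank-cancel-< : ∀ t {u v} → rank t v < rank t u → v < u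
  rank-cancel-< t r = ≰⇒> (λ u≤v → n≮n _ (≤-trans r (rank-mono t u≤v)))

  count< : ℕ → List ℕ → ℕ
  count< x t = length (filter (_<? x) t)

  rank-distinct₃ : ∀ {u v w} x → u ≢ v → v ≢ w → u ≢ w → rank (u ∷ v ∷ [ w ]) x ≡ count< x (u ∷ v ∷ [ w ])
  rank-distinct₃ {u} {v} {w} x u≢v v≢w u≢w
    rewrite dec-false (v ≟ w) v≢w | dec-false (u ≟ v) u≢v | dec-false (u ≟ w) u≢w = refl

  reduce-distinct₃ : ∀ {u v w} → u ≢ v → v ≢ w → u ≢ w →
    reduce (u ∷ v ∷ [ w ]) ≡ map (λ x → count< x (u ∷ v ∷ [ w ])) (u ∷ v ∷ [ w ])
  reduce-distinct₃ {u} {v} {w} u≢v v≢w u≢w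
    rewrite rank-distinct₃ u u≢v v≢w u≢w | rank-distinct₃ v u≢v v≢w u≢w | rank-distinct₃ w u≢v v≢w u≢w = refl

  reduce-210 : ∀ {u v w} → w < v → v < u → reduce (u ∷ v ∷ [ w ]) ≡ 2 ∷ 1 ∷ [ 0 ]
  reduce-210 {u} {v} {w} w<v v<u with <-trans w<v v<u
  ... | w<u
    rewrite reduce-distinct₃ (>⇒≢ v<u) (>⇒≢ w<v) (>⇒≢ w<u)
    | dec-false (u <? u) (n≮n u) | dec-true (v <? u) v<u | dec-true (w <? u) w<u
    | dec-false (u <? v) (<-asym v<u) | dec-false (v <? v) (n≮n v) | dec-true (w <? v) w<v
    | dec-false (u <? w) (<-asym w<u) | dec-false (v <? w) (<-asym w<v) | dec-false (w <? w) (n≮n w)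
    = refl

  reduce-201 : ∀ {u v w} → v < w → w < u → reduce (u ∷ v ∷ [ w ]) ≡ 2 ∷ 0 ∷ [ 1 ]
  reduce-201 {u} {v} {w} v<w w<u with <-trans v<w w<u
  ... | v<u
    rewrite reduce-distinct₃ (>⇒≢ v<u) (<⇒≢ v<w) (>⇒≢ w<u)
    | dec-false (u <? u) (n≮n u) | dec-true (v <? u) v<u | dec-true (w <? u) w<u
    | dec-false (u <? v) (<-asym v<u) | dec-false (v <? v) (n≮n v) | dec-false (w <? v) (<-asym v<w)
    | dec-false (u <? w) (<-asym w<u) | dec-true (v <? w) v<w | dec-false (w <? w) (n≮n w)
    = refl

  reduce-102 : ∀ {u v w} → v < u → u < w → reduce (u ∷ v ∷ [ w ]) ≡ 1 ∷ 0 ∷ [ 2 ]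
  reduce-102 {u} {v} {w} v<u u<w with <-trans v<u u<w
  ... | v<w
    rewrite reduce-distinct₃ (>⇒≢ v<u) (<⇒≢ v<w) (<⇒≢ u<w)
    | dec-false (u <? u) (n≮n u) | dec-true (v <? u) v<u | dec-false (w <? u) (<-asym u<w)
    | dec-false (u <? v) (<-asym v<u) | dec-false (v <? v) (n≮n v) | dec-false (w <? v) (<-asym v<w)
    | dec-true (u <? w) u<w | dec-true (v <? w) v<w | dec-false (w <? w) (n≮n w)
    = refl

  contains⇒forbidden : ∀ {r₁ r₂ r₃} s → r₂ < r₁ → r₃ ≢ r₁ → r₃ ≢ r₂ →
                       Contains (r₁ ∷ r₂ ∷ [ r₃ ]) s → Forbidden s
  contains⇒forbidden s r₂<r₁ r₃≢r₁ r₃≢r₂ c with find c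
  ... | u ∷ v ∷ w ∷ [] , p , eq with ∷-injective eq
  ...   | ru , eq₂ with ∷-injective eq₂
  ...     | rv , eq₃ with ∷-injective eq₃
  ...       | rw , _ =
    u , v , w , p ,
    rank-cancel-< t (subst₂ _<_ (sym rv) (sym ru) r₂<r₁) ,
    (λ { refl → r₃≢r₁ (trans (sym rw) ru) }) ,
    (λ { refl → r₃≢r₂ (trans (sym rw) rv) })
    where
    t = u ∷ v ∷ [ w ]

  avoidsAll⇒¬forbidden : ∀ s → AvoidsAll s → ¬ Forbidden s
  avoidsAll⇒¬forbidden s (¬102 ∷ ¬201 ∷ ¬210 ∷ []) (u , v , w , p , v<u , w≢u , w≢v) with <-cmp w v
  ... | tri< w<v _ _ = ¬210 (lose p (reduce-210 w<v v<u))
  ... | tri≈ _ w≡v _ = w≢v w≡v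
  ... | tri> _ _ v<w with <-cmp w u
  ...   | tri< w<u _ _ = ¬201 (lose p (reduce-201 v<w w<u))
  ...   | tri≈ _ w≡u _ = w≢u w≡u
  ...   | tri> _ _ u<w = ¬102 (lose p (reduce-102 v<u u<w))

  ¬forbidden⇒avoidsAll : ∀ s → ¬ Forbidden s → AvoidsAll s
  ¬forbidden⇒avoidsAll s ok =
    (λ c → ok (contains⇒forbidden s (s≤s z≤n) (λ ()) (λ ()) c)) ∷
    (λ c → ok (contains⇒forbidden s (s≤s z≤n) (λ ()) (λ ()) c)) ∷
    (λ c → ok (contains⇒forbidden s (s≤s (s≤s z≤n)) (λ ()) (λ ()) c)) ∷ []

module Automaton where
  open InversionSequences
  open Patterns
  open import Data.Nat.Base using (_<_; _≤_; z≤n; s≤s; pred)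
  open import Data.Nat.Properties
    using (_≟_; _≤?_; <-cmp; ≰⇒>; n≮n; ≤pred⇒≤; <-trans; ≤-refl; ≤-trans; <⇒≤; <-≤-trans; ≤-<-trans; <⇒≢; m≤n⇒m≤1+n)
  open import Data.List.Base using (foldl)
  open import Data.List.Properties using (foldl-∷ʳ)
  open import Data.List.Membership.Propositional using (_∈_)
  open import Data.List.Relation.Unary.Any using (here; there)
  open import Data.Unit using (⊤; tt)
  open import Data.Bool.Base using (Bool; true; false)
  open import Relation.Nullary.Decidable using (dec-true; dec-false)
  open import Relation.Binary.Definitions using (Tri; tri<; tri≈; tri>)

  data State : Set where
    ascending : (M m : ℕ) → State
    descended : (M x : ℕ) → State
    locked    : (x : ℕ) → State
    dead      : State

  step-below : (M m a : ℕ) → Dec (m ≤ a) → State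
  step-below M m a (yes _) = descended M a
  step-below M m a (no _)  = locked a

  step-ascending : (M m a : ℕ) → Tri (a < M) (a ≡ M) (M < a) → State
  step-ascending M m a (tri< _ _ _) = step-below M m a (m ≤? a)
  step-ascending M m a (tri≈ _ _ _) = ascending M m
  step-ascending M m a (tri> _ _ _) = ascending a M

  step-descended : (M x a : ℕ) → Dec (a ≡ M) → Dec (a ≡ x) → State
  step-descended M x a (yes _) _       = descended M x
  step-descended M x a (no _)  (yes _) = descended M x
  step-descended M x a (no _)  (no _)  = dead

  step-locked : (x a : ℕ) → Dec (a ≡ x) → State
  step-locked x a (yes _) = locked x
  step-locked x a (no _)  = dead

  step : State → ℕ → State
  step (ascending M m) a = step-ascending M m a (<-cmp a M)
  step (descended M x) a = step-descended M x a (a ≟ M) (a ≟ x)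
  step (locked x)      a = step-locked x a (a ≟ x)
  step dead            a = dead

  state : List ℕ → State
  state = foldl step (ascending 0 0)

  state-∷ʳ : ∀ s a → state (s ∷ʳ a) ≡ step (state s) a
  state-∷ʳ s a = foldl-∷ʳ step (ascending 0 0) a s

  step-below-second : ∀ {M m a} → a < m → m ≤ M → step (ascending M m) a ≡ locked a
  step-below-second {M} {m} {a} a<m m≤M with <-cmp a M
  ... | tri≈ _ refl _ = ⊥-elim (n≮n _ (<-≤-trans a<m m≤M))
  ... | tri> _ _ M<a  = ⊥-elim (n≮n _ (<-trans M<a (<-≤-trans a<m m≤M)))
  ... | tri< _ _ _ with m ≤? a
  ...   | yes m≤a = ⊥-elim (n≮n _ (<-≤-trans a<m m≤a))
  ...   | no _    = refl

  step-between : ∀ {M m a} → m ≤ a → a < M → step (ascending M m) a ≡ descended M a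
  step-between {M} {m} {a} m≤a a<M with <-cmp a M
  ... | tri≈ _ refl _ = ⊥-elim (n≮n _ a<M)
  ... | tri> _ _ M<a  = ⊥-elim (n≮n _ (<-trans a<M M<a))
  ... | tri< _ _ _ with m ≤? a
  ...   | yes _   = refl
  ...   | no m≰a  = ⊥-elim (m≰a m≤a)

  step-max : ∀ M m → step (ascending M m) M ≡ ascending M m
  step-max M m with <-cmp M M
  ... | tri< M<M _ _ = ⊥-elim (n≮n _ M<M)
  ... | tri≈ _ _ _   = refl
  ... | tri> _ _ M<M = ⊥-elim (n≮n _ M<M)

  step-above : ∀ {M m a} → M < a → step (ascending M m) a ≡ ascending a M
  step-above {M} {m} {a} M<a with <-cmp a M
  ... | tri< a<M _ _  = ⊥-elim (n≮n _ (<-trans a<M M<a))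
  ... | tri≈ _ refl _ = ⊥-elim (n≮n _ M<a)
  ... | tri> _ _ _    = refl

  NoDescent : List ℕ → Set
  NoDescent s = ∀ u v → u ∷ [ v ] ⊑ s → v < u → ⊥

  -- m is the largest entry below the maximum M, or 0 if there is none.
  record Ascending (s : List ℕ) (M m : ℕ) : Set where
    field
      avoids        : ¬ Forbidden s
      no-descent    : NoDescent s
      ≤-max         : ∀ u → [ u ] ⊑ s → u ≤ M
      max-occurs    : 0 < M → [ M ] ⊑ s
      ≤-second      : ∀ u → [ u ] ⊑ s → u < M → u ≤ m
      second-occurs : 0 < m → [ m ] ⊑ s
      second<max    : 0 < M → m < M

  record Descended (s : List ℕ) (M x : ℕ) : Set where
    field
      avoids   : ¬ Forbidden s
      descents : ∀ u v → u ∷ [ v ] ⊑ s → v < u → u ≡ M × v ≡ x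
      descent  : M ∷ [ x ] ⊑ s
      x<M      : x < M
      entries  : ∀ u → [ u ] ⊑ s → u ≤ x ⊎ u ≡ M

  record Locked (s : List ℕ) (x : ℕ) : Set where
    field
      avoids   : ¬ Forbidden s
      descents : ∀ u v → u ∷ [ v ] ⊑ s → v < u → v ≡ x
      u₁ u₂    : ℕ
      descent₁ : u₁ ∷ [ x ] ⊑ s
      descent₂ : u₂ ∷ [ x ] ⊑ s
      x<u₁     : x < u₁
      x<u₂     : x < u₂
      u₁≢u₂    : u₁ ≢ u₂

  Invariant : List ℕ → State → Set
  Invariant s (ascending M m) = Ascending s M m
  Invariant s (descended M x) = Descended s M x
  Invariant s (locked x)      = Locked s x
  Invariant s dead            = Forbidden s

  invariant-[] : Invariant [] (ascending 0 0)
  invariant-[] = record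
    { avoids        = λ { (_ , _ , _ , there () , _) }
    ; no-descent    = λ { _ _ (there ()) _ }
    ; ≤-max         = λ { _ (there ()) }
    ; max-occurs    = λ ()
    ; ≤-second      = λ { _ (there ()) _ }
    ; second-occurs = λ ()
    ; second<max    = λ ()
    }

  entry-∷ʳ⁻ : ∀ (s : List ℕ) {a u} → [ u ] ⊑ s ∷ʳ a → [ u ] ⊑ s ⊎ u ≡ a
  entry-∷ʳ⁻ s p with ∷ʳ-⊑-∷ʳ⁻ s [] p
  ... | inj₁ q       = inj₁ q
  ... | inj₂ (u≡a , _) = inj₂ u≡a

  new-entry : ∀ (s : List ℕ) {a} → [ a ] ⊑ s ∷ʳ a
  new-entry s = ∷ʳ-⊑-∷ʳ s ([]⊑ s)

  no-descent-∷ʳ : ∀ s {a} → NoDescent s → (∀ u → [ u ] ⊑ s → u ≤ a) → NoDescent (s ∷ʳ a)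
  no-descent-∷ʳ s none ≤a u v p v<u with ∷ʳ-⊑-∷ʳ⁻ s [ u ] p
  ... | inj₁ q          = none u v q v<u
  ... | inj₂ (refl , q) = n≮n v (<-≤-trans v<u (≤a u q))

  ≤-∷ʳ : ∀ s {a} → (∀ u → [ u ] ⊑ s → u ≤ a) → ∀ u → [ u ] ⊑ s ∷ʳ a → u ≤ a
  ≤-∷ʳ s ≤a u p with entry-∷ʳ⁻ s p
  ... | inj₁ q    = ≤a u q
  ... | inj₂ refl = ≤-refl

  below-new-entry : ∀ s {a u} → [ u ] ⊑ s ∷ʳ a → u < a → [ u ] ⊑ s
  below-new-entry s p u<a with entry-∷ʳ⁻ s p
  ... | inj₁ q    = q
  ... | inj₂ refl = ⊥-elim (n≮n _ u<a)

  ascending-entries : ∀ {s M m} → Ascending s M m → ∀ u → [ u ] ⊑ s → u ≤ m ⊎ u ≡ M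
  ascending-entries {M = M} I u p with <-cmp u M
  ... | tri< u<M _ _ = inj₁ (Ascending.≤-second I u p u<M)
  ... | tri≈ _ u≡M _ = inj₂ u≡M
  ... | tri> _ _ M<u = ⊥-elim (n≮n _ (<-≤-trans M<u (Ascending.≤-max I u p)))

  new-descent : ∀ s {a u v} → NoDescent s → u ∷ [ v ] ⊑ s ∷ʳ a → v < u → v ≡ a × [ u ] ⊑ s
  new-descent s none p v<u with ∷ʳ-⊑-∷ʳ⁻ s [ _ ] p
  ... | inj₁ q      = ⊥-elim (none _ _ q v<u)
  ... | inj₂ result = result

  ascending-avoids-∷ʳ : ∀ s {M m a} → Ascending s M m → ¬ Forbidden (s ∷ʳ a)
  ascending-avoids-∷ʳ s I = ¬forbidden-∷ʳ s avoids (λ u v p v<u → ⊥-elim (no-descent u v p v<u))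
    where open Ascending I

  ascending-step-below : ∀ s {M m a} (d : Dec (m ≤ a)) → a < M → Ascending s M m →
                         Invariant (s ∷ʳ a) (step-below M m a d)
  ascending-step-below s {M} {m} {a} (yes m≤a) a<M I = record
    { avoids   = ascending-avoids-∷ʳ s I
    ; descents = descents′
    ; descent  = ∷ʳ-⊑-∷ʳ s (max-occurs (≤-<-trans z≤n a<M))
    ; x<M      = a<M
    ; entries  = entries′
    }
    where
    open Ascending I
    descents′ : ∀ u v → u ∷ [ v ] ⊑ s ∷ʳ a → v < u → u ≡ M × v ≡ a
    descents′ u v p v<u with new-descent s no-descent p v<u
    ... | refl , q with ascending-entries I u q
    ...   | inj₁ u≤m = ⊥-elim (n≮n _ (<-≤-trans v<u (≤-trans u≤m m≤a)))
    ...   | inj₂ u≡M = u≡M , refl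
    entries′ : ∀ u → [ u ] ⊑ s ∷ʳ a → u ≤ a ⊎ u ≡ M
    entries′ u p with entry-∷ʳ⁻ s p
    ... | inj₂ refl = inj₁ ≤-refl
    ... | inj₁ q with ascending-entries I u q
    ...   | inj₁ u≤m = inj₁ (≤-trans u≤m m≤a)
    ...   | inj₂ u≡M = inj₂ u≡M
  ascending-step-below s {M} {m} {a} (no m≰a) a<M I = record
    { avoids   = ascending-avoids-∷ʳ s I
    ; descents = λ u v p v<u → proj₁ (new-descent s no-descent p v<u)
    ; u₁       = M
    ; u₂       = m
    ; descent₁ = ∷ʳ-⊑-∷ʳ s (max-occurs 0<M)
    ; descent₂ = ∷ʳ-⊑-∷ʳ s (second-occurs (≤-<-trans z≤n a<m))
    ; x<u₁     = a<M
    ; x<u₂     = a<m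
    ; u₁≢u₂    = λ M≡m → <⇒≢ (second<max 0<M) (sym M≡m)
    }
    where
    open Ascending I
    a<m = ≰⇒> m≰a
    0<M = ≤-<-trans z≤n a<M

  ascending-step : ∀ s {M m a} (t : Tri (a < M) (a ≡ M) (M < a)) →
                   Invariant s (ascending M m) → Invariant (s ∷ʳ a) (step-ascending M m a t)
  ascending-step s {m = m} {a} (tri< a<M _ _) I = ascending-step-below s (m ≤? a) a<M I
  ascending-step s (tri≈ _ refl _) I = record
    { avoids        = ascending-avoids-∷ʳ s I
    ; no-descent    = no-descent-∷ʳ s no-descent ≤-max
    ; ≤-max         = ≤-∷ʳ s ≤-max
    ; max-occurs    = λ _ → new-entry s
    ; ≤-second      = λ u p u<a → ≤-second u (below-new-entry s p u<a) u<a
    ; second-occurs = λ 0<m → ⊑-∷ʳ s (second-occurs 0<m)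
    ; second<max    = second<max
    }
    where open Ascending I
  ascending-step s {M} {a = a} (tri> _ _ M<a) I = record
    { avoids        = ascending-avoids-∷ʳ s I
    ; no-descent    = no-descent-∷ʳ s no-descent ≤a
    ; ≤-max         = ≤-∷ʳ s ≤a
    ; max-occurs    = λ _ → new-entry s
    ; ≤-second      = λ u p u<a → ≤-max u (below-new-entry s p u<a)
    ; second-occurs = λ 0<M → ⊑-∷ʳ s (max-occurs 0<M)
    ; second<max    = λ _ → M<a
    }
    where
    open Ascending I
    ≤a : ∀ u → [ u ] ⊑ s → u ≤ a
    ≤a u p = ≤-trans (≤-max u p) (<⇒≤ M<a)

  descended-step : ∀ s {M x a} (d₁ : Dec (a ≡ M)) (d₂ : Dec (a ≡ x)) →
                   Invariant s (descended M x) → Invariant (s ∷ʳ a) (step-descended M x a d₁ d₂)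
  descended-step s {x = x} {a} (yes refl) _ D = record
    { avoids   = ¬forbidden-∷ʳ s avoids (λ u v p v<u → inj₁ (sym (proj₁ (descents u v p v<u))))
    ; descents = descents′
    ; descent  = ⊑-∷ʳ s descent
    ; x<M      = x<M
    ; entries  = entries′
    }
    where
    open Descended D
    descents′ : ∀ u v → u ∷ [ v ] ⊑ s ∷ʳ a → v < u → u ≡ a × v ≡ x
    descents′ u v p v<u with ∷ʳ-⊑-∷ʳ⁻ s [ u ] p
    ... | inj₁ q = descents u v q v<u
    ... | inj₂ (refl , q) with entries u q
    ...   | inj₁ u≤x  = ⊥-elim (n≮n _ (<-trans v<u (≤-<-trans u≤x x<M)))
    ...   | inj₂ refl = ⊥-elim (n≮n _ v<u)
    entries′ : ∀ u → [ u ] ⊑ s ∷ʳ a → u ≤ x ⊎ u ≡ a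
    entries′ u p with entry-∷ʳ⁻ s p
    ... | inj₁ q    = entries u q
    ... | inj₂ refl = inj₂ refl
  descended-step s {M} {x} {a} (no _) (yes refl) D = record
    { avoids   = ¬forbidden-∷ʳ s avoids (λ u v p v<u → inj₂ (sym (proj₂ (descents u v p v<u))))
    ; descents = descents′
    ; descent  = ⊑-∷ʳ s descent
    ; x<M      = x<M
    ; entries  = entries′
    }
    where
    open Descended D
    descents′ : ∀ u v → u ∷ [ v ] ⊑ s ∷ʳ a → v < u → u ≡ M × v ≡ a
    descents′ u v p v<u with ∷ʳ-⊑-∷ʳ⁻ s [ u ] p
    ... | inj₁ q = descents u v q v<u
    ... | inj₂ (refl , q) with entries u q
    ...   | inj₁ u≤x = ⊥-elim (n≮n _ (<-≤-trans v<u u≤x))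
    ...   | inj₂ u≡M = u≡M , refl
    entries′ : ∀ u → [ u ] ⊑ s ∷ʳ a → u ≤ a ⊎ u ≡ M
    entries′ u p with entry-∷ʳ⁻ s p
    ... | inj₁ q    = entries u q
    ... | inj₂ refl = inj₁ ≤-refl
  descended-step s (no a≢M) (no a≢x) D = forbidden-completed s descent x<M a≢M a≢x
    where open Descended D

  locked-step : ∀ s {x a} (d : Dec (a ≡ x)) → Invariant s (locked x) → Invariant (s ∷ʳ a) (step-locked x a d)
  locked-step s {x} (yes refl) L = record
    { avoids   = ¬forbidden-∷ʳ s avoids (λ u v p v<u → inj₂ (sym (descents u v p v<u)))
    ; descents = descents′
    ; u₁       = u₁
    ; u₂       = u₂
    ; descent₁ = ⊑-∷ʳ s descent₁
    ; descent₂ = ⊑-∷ʳ s descent₂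
    ; x<u₁     = x<u₁
    ; x<u₂     = x<u₂
    ; u₁≢u₂    = u₁≢u₂
    }
    where
    open Locked L
    descents′ : ∀ u v → u ∷ [ v ] ⊑ s ∷ʳ x → v < u → v ≡ x
    descents′ u v p v<u with ∷ʳ-⊑-∷ʳ⁻ s [ u ] p
    ... | inj₁ q       = descents u v q v<u
    ... | inj₂ (v≡a , _) = v≡a
  locked-step s {a = a} (no a≢x) L = completed (a ≟ u₁)
    where
    open Locked L
    completed : Dec (a ≡ u₁) → Forbidden (s ∷ʳ a)
    completed (yes refl) = forbidden-completed s descent₂ x<u₂ u₁≢u₂ a≢x
    completed (no a≢u₁)  = forbidden-completed s descent₁ x<u₁ a≢u₁ a≢x

  invariant-step : ∀ s σ a → Invariant s σ → Invariant (s ∷ʳ a) (step σ a)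
  invariant-step s (ascending M m) a = ascending-step s (<-cmp a M)
  invariant-step s (descended M x) a = descended-step s (a ≟ M) (a ≟ x)
  invariant-step s (locked x)      a = locked-step s (a ≟ x)
  invariant-step s dead            a = forbidden-∷ʳ s

  Bounded : ℕ → State → Set
  Bounded n (ascending M m) = M ≤ pred n × m ≤ M
  Bounded n (descended M x) = x < M × M ≤ n
  Bounded n (locked x)      = x ≤ n
  Bounded n dead            = ⊤

  bounded-step : ∀ n σ a → Bounded n σ → a < suc n → Bounded (suc n) (step σ a)
  bounded-step n (ascending M m) a (M≤ , m≤M) (s≤s a≤n) = go (<-cmp a M)
    where
    M≤n : M ≤ n
    M≤n = ≤pred⇒≤ M≤
    go : (t : Tri (a < M) (a ≡ M) (M < a)) → Bounded (suc n) (step-ascending M m a t)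
    go (tri< a<M _ _) with m ≤? a
    ... | yes _ = a<M , m≤n⇒m≤1+n M≤n
    ... | no _  = m≤n⇒m≤1+n a≤n
    go (tri≈ _ _ _)   = M≤n , m≤M
    go (tri> _ _ M<a) = a≤n , <⇒≤ M<a
  bounded-step n (descended M x) a (x<M , M≤n) _ = go (a ≟ M) (a ≟ x)
    where
    go : (d₁ : Dec (a ≡ M)) (d₂ : Dec (a ≡ x)) → Bounded (suc n) (step-descended M x a d₁ d₂)
    go (yes _) _       = x<M , m≤n⇒m≤1+n M≤n
    go (no _)  (yes _) = x<M , m≤n⇒m≤1+n M≤n
    go (no _)  (no _)  = tt
  bounded-step n (locked x) a x≤n _ = go (a ≟ x)
    where
    go : (d : Dec (a ≡ x)) → Bounded (suc n) (step-locked x a d)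
    go (yes _) = m≤n⇒m≤1+n x≤n
    go (no _)  = tt
  bounded-step n dead a _ _ = tt

  reachable : ∀ n {s} → s ∈ invSeqs n → Bounded n (state s) × Invariant s (state s)
  reachable zero (here refl) = (z≤n , z≤n) , invariant-[]
  reachable (suc n) p with invSeqs-∷ʳ⁻ p
  ... | s , a , refl , s∈ , a<1+n rewrite state-∷ʳ s a with reachable n s∈
  ...   | bounded , invariant = bounded-step n (state s) a bounded a<1+n , invariant-step s (state s) a invariant

  alive : State → Bool
  alive dead = false
  alive _    = true

  avoids?≡alive : ∀ {s} σ → Invariant s σ → does (avoidsAll? s) ≡ alive σ
  avoids?≡alive {s} (ascending _ _) I = dec-true (avoidsAll? s) (¬forbidden⇒avoidsAll s (Ascending.avoids I))
  avoids?≡alive {s} (descended _ _) I = dec-true (avoidsAll? s) (¬forbidden⇒avoidsAll s (Descended.avoids I))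
  avoids?≡alive {s} (locked _)      I = dec-true (avoidsAll? s) (¬forbidden⇒avoidsAll s (Locked.avoids I))
  avoids?≡alive {s} dead            f = dec-false (avoidsAll? s) (λ av → avoidsAll⇒¬forbidden s av f)

module Sums where
  open import Data.Nat.Base as ℕ using (_<_; _≤_; _∸_; z≤n; s≤s)
  open import Data.Nat.Properties using (m+[n∸m]≡n; +-∸-assoc)
  open import Data.Integer.Base using (ℤ; +_; 0ℤ; 1ℤ; _+_; _*_)
  open import Data.Integer.Properties
    using (+-identityˡ; +-identityʳ; +-assoc; +-comm; *-distribˡ-+; *-zeroʳ; *-identityʳ; +-commutativeSemigroup)
  open import Data.List.Base using (_++_; foldr; filter; length; concatMap; applyUpTo)
  open import Data.List.Membership.Propositional using (_∈_)
  open import Data.List.Relation.Unary.Any using (here; there)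
  open import Data.Bool.Base using (if_then_else_; true; false)
  open import Algebra.Properties.CommutativeSemigroup +-commutativeSemigroup using (interchange)
  open import Data.Integer.Tactic.RingSolver using (solve-∀)
  import Data.Nat.Tactic.RingSolver as ℕ-Solver
  open ≡-Reasoning

  ∑ : ℕ → (ℕ → ℤ) → ℤ
  ∑ zero    f = 0ℤ
  ∑ (suc n) f = f 0 + ∑ n (λ i → f (suc i))

  syntax ∑ n (λ i → e) = ∑[ i < n ] e

  ∑-cong : ∀ n {f g} → (∀ i → i < n → f i ≡ g i) → ∑ n f ≡ ∑ n g
  ∑-cong zero    eq = refl
  ∑-cong (suc n) eq = cong₂ _+_ (eq 0 (s≤s z≤n)) (∑-cong n (λ i i<n → eq (suc i) (s≤s i<n)))

  ∑-distrib-+ : ∀ n f g → ∑[ i < n ] (f i + g i) ≡ ∑ n f + ∑ n g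
  ∑-distrib-+ zero    f g = refl
  ∑-distrib-+ (suc n) f g = trans (cong (_+_ (f 0 + g 0)) (∑-distrib-+ n _ _)) (interchange (f 0) (g 0) _ _)

  *-distribˡ-∑ : ∀ n c f → c * ∑ n f ≡ ∑[ i < n ] (c * f i)
  *-distribˡ-∑ zero    c f = *-zeroʳ c
  *-distribˡ-∑ (suc n) c f = trans (*-distribˡ-+ c (f 0) _) (cong (_+_ (c * f 0)) (*-distribˡ-∑ n c _))

  ∑-const : ∀ n c → ∑[ i < n ] c ≡ + n * c
  ∑-const zero    c = refl
  ∑-const (suc n) c = trans (cong (_+_ c) (∑-const n c)) (lemma (+ n) c)
    where
    lemma : ∀ n c → c + n * c ≡ (+ 1 + n) * c
    lemma = solve-∀

  ∑-zero : ∀ n → ∑[ i < n ] 0ℤ ≡ 0ℤ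
  ∑-zero zero    = refl
  ∑-zero (suc n) = trans (+-identityˡ _) (∑-zero n)

  ∑-split : ∀ p q f → ∑ (p ℕ.+ q) f ≡ ∑ p f + ∑[ i < q ] f (p ℕ.+ i)
  ∑-split zero    q f = sym (+-identityˡ _)
  ∑-split (suc p) q f = trans (cong (_+_ (f 0)) (∑-split p q _)) (sym (+-assoc (f 0) _ _))

  ∑-split-at : ∀ {p n} f → p ≤ n → ∑ n f ≡ ∑ p f + ∑[ i < n ∸ p ] f (p ℕ.+ i)
  ∑-split-at {p} {n} f p≤n = trans (cong (λ k → ∑ k f) (sym (m+[n∸m]≡n p≤n))) (∑-split p (n ∸ p) f)

  ∑-last : ∀ n f → ∑ (suc n) f ≡ ∑ n f + f n
  ∑-last zero    f = trans (+-identityʳ (f 0)) (sym (+-identityˡ (f 0)))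
  ∑-last (suc n) f = trans (cong (_+_ (f 0)) (∑-last n _)) (sym (+-assoc (f 0) _ _))

  ∑-reverse : ∀ n f → ∑[ i < n ] f (n ∸ suc i) ≡ ∑ n f
  ∑-reverse zero    f = refl
  ∑-reverse (suc n) f = begin
    f n + ∑[ i < n ] f (n ∸ suc i) ≡⟨ cong (_+_ (f n)) (∑-reverse n f) ⟩
    f n + ∑ n f                    ≡⟨ +-comm (f n) _ ⟩
    ∑ n f + f n                    ≡⟨ ∑-last n f ⟨
    ∑ (suc n) f                    ∎

  ∑-countdown : ∀ n g → ∑[ i < n ] g (n ∸ i) ≡ ∑[ i < n ] g (suc i)
  ∑-countdown n g = trans (∑-cong n (λ i i<n → cong g (+-∸-assoc 1 i<n))) (∑-reverse n (λ i → g (suc i)))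

  triangle : ℕ → ℤ
  triangle n = ∑[ i < n ] (+ suc i)

  triangle-double : ∀ n → + 2 * triangle n ≡ + (n ℕ.* suc n)
  triangle-double zero    = refl
  triangle-double (suc n) = begin
    + 2 * triangle (suc n)             ≡⟨ cong (λ t → + 2 * t) (∑-last n (λ i → + suc i)) ⟩
    + 2 * (triangle n + + suc n)       ≡⟨ *-distribˡ-+ (+ 2) (triangle n) (+ suc n) ⟩
    + 2 * triangle n + + 2 * + suc n   ≡⟨ cong (λ t → t + + (2 ℕ.* suc n)) (triangle-double n) ⟩
    + (n ℕ.* suc n ℕ.+ 2 ℕ.* suc n)    ≡⟨ cong +_ (lemma n) ⟩
    + (suc n ℕ.* suc (suc n))          ∎
    where
    lemma : ∀ n → n ℕ.* suc n ℕ.+ 2 ℕ.* suc n ≡ suc n ℕ.* suc (suc n)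
    lemma = ℕ-Solver.solve-∀

  ⟦_≤_⟧ : ℕ → ℕ → ℤ
  ⟦ zero  ≤ x     ⟧ = 1ℤ
  ⟦ suc y ≤ zero  ⟧ = 0ℤ
  ⟦ suc y ≤ suc x ⟧ = ⟦ y ≤ x ⟧

  ⟦_≡_⟧ : ℕ → ℕ → ℤ
  ⟦ zero  ≡ zero  ⟧ = 1ℤ
  ⟦ zero  ≡ suc x ⟧ = 0ℤ
  ⟦ suc y ≡ zero  ⟧ = 0ℤ
  ⟦ suc y ≡ suc x ⟧ = ⟦ y ≡ x ⟧

  ⟦≤⟧-yes : ∀ {y x} → y ≤ x → ⟦ y ≤ x ⟧ ≡ 1ℤ
  ⟦≤⟧-yes z≤n       = refl
  ⟦≤⟧-yes (s≤s y≤x) = ⟦≤⟧-yes y≤x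

  ⟦≤⟧-no : ∀ {y x} → x < y → ⟦ y ≤ x ⟧ ≡ 0ℤ
  ⟦≤⟧-no {suc y} {zero}  _         = refl
  ⟦≤⟧-no {suc y} {suc x} (s≤s x<y) = ⟦≤⟧-no x<y

  ⟦≡⟧-refl : ∀ x → ⟦ x ≡ x ⟧ ≡ 1ℤ
  ⟦≡⟧-refl zero    = refl
  ⟦≡⟧-refl (suc x) = ⟦≡⟧-refl x

  ⟦≡⟧-no : ∀ {y x} → y ≢ x → ⟦ y ≡ x ⟧ ≡ 0ℤ
  ⟦≡⟧-no {zero}  {zero}  y≢x = ⊥-elim (y≢x refl)
  ⟦≡⟧-no {zero}  {suc x} _   = refl
  ⟦≡⟧-no {suc y} {zero}  _   = refl
  ⟦≡⟧-no {suc y} {suc x} y≢x = ⟦≡⟧-no (λ y≡x → y≢x (cong suc y≡x))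

  ⟦≤⟧-split : ∀ y x → ⟦ y ≤ x ⟧ ≡ ⟦ y ≡ x ⟧ + ⟦ suc y ≤ x ⟧
  ⟦≤⟧-split zero    zero    = refl
  ⟦≤⟧-split zero    (suc x) = refl
  ⟦≤⟧-split (suc y) zero    = refl
  ⟦≤⟧-split (suc y) (suc x) = ⟦≤⟧-split y x

  ∑-⟦≡⟧ : ∀ y n → ∑[ i < n ] ⟦ y ≡ i ⟧ ≡ ⟦ suc y ≤ n ⟧
  ∑-⟦≡⟧ y       zero    = refl
  ∑-⟦≡⟧ zero    (suc n) = cong (_+_ 1ℤ) (∑-zero n)
  ∑-⟦≡⟧ (suc y) (suc n) = trans (+-identityˡ _) (∑-⟦≡⟧ y n)

  ∑-point : ∀ n p c → p < n → ∑[ i < n ] (c * ⟦ p ≡ i ⟧) ≡ c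
  ∑-point n p c p<n = begin
    ∑[ i < n ] (c * ⟦ p ≡ i ⟧) ≡⟨ *-distribˡ-∑ n c _ ⟨
    c * ∑[ i < n ] ⟦ p ≡ i ⟧   ≡⟨ cong (c *_) (trans (∑-⟦≡⟧ p n) (⟦≤⟧-yes p<n)) ⟩
    c * 1ℤ                     ≡⟨ *-identityʳ c ⟩
    c                          ∎


  private variable A B : Set

  ∑∈ : List A → (A → ℤ) → ℤ
  ∑∈ xs g = foldr _+_ 0ℤ (map g xs)

  syntax ∑∈ xs (λ x → e) = ∑[ x ∈ xs ] e

  ∑∈-cong : ∀ (xs : List A) {g h} → (∀ x → x ∈ xs → g x ≡ h x) → ∑∈ xs g ≡ ∑∈ xs h
  ∑∈-cong []       eq = refl
  ∑∈-cong (x ∷ xs) eq = cong₂ _+_ (eq x (here refl)) (∑∈-cong xs (λ y y∈ → eq y (there y∈)))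

  ∑∈-distrib-+ : ∀ (xs : List A) g h → ∑[ x ∈ xs ] (g x + h x) ≡ ∑∈ xs g + ∑∈ xs h
  ∑∈-distrib-+ []       g h = refl
  ∑∈-distrib-+ (x ∷ xs) g h = trans (cong (_+_ (g x + h x)) (∑∈-distrib-+ xs g h)) (interchange (g x) (h x) _ _)

  *-distribˡ-∑∈ : ∀ (xs : List A) c g → c * ∑∈ xs g ≡ ∑[ x ∈ xs ] (c * g x)
  *-distribˡ-∑∈ []       c g = *-zeroʳ c
  *-distribˡ-∑∈ (x ∷ xs) c g = trans (*-distribˡ-+ c (g x) _) (cong (_+_ (c * g x)) (*-distribˡ-∑∈ xs c g))

  ∑∈-zero : ∀ (xs : List A) → ∑[ x ∈ xs ] 0ℤ ≡ 0ℤ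
  ∑∈-zero []       = refl
  ∑∈-zero (x ∷ xs) = trans (+-identityˡ _) (∑∈-zero xs)

  ∑∈-++ : ∀ (xs ys : List A) g → ∑∈ (xs ++ ys) g ≡ ∑∈ xs g + ∑∈ ys g
  ∑∈-++ []       ys g = sym (+-identityˡ _)
  ∑∈-++ (x ∷ xs) ys g = trans (cong (_+_ (g x)) (∑∈-++ xs ys g)) (sym (+-assoc (g x) _ _))

  ∑∈-concatMap : ∀ (f : A → List B) xs g → ∑∈ (concatMap f xs) g ≡ ∑[ x ∈ xs ] ∑∈ (f x) g
  ∑∈-concatMap f []       g = refl
  ∑∈-concatMap f (x ∷ xs) g = trans (∑∈-++ (f x) _ g) (cong (_+_ (∑∈ (f x) g)) (∑∈-concatMap f xs g))

  ∑∈-map : ∀ (f : A → B) xs g → ∑∈ (map f xs) g ≡ ∑[ x ∈ xs ] g (f x)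
  ∑∈-map f []       g = refl
  ∑∈-map f (x ∷ xs) g = cong (_+_ (g (f x))) (∑∈-map f xs g)

  ∑∈-applyUpTo : ∀ (f : ℕ → ℕ) n g → ∑∈ (applyUpTo f n) g ≡ ∑[ i < n ] g (f i)
  ∑∈-applyUpTo f zero    g = refl
  ∑∈-applyUpTo f (suc n) g = cong (_+_ (g (f 0))) (∑∈-applyUpTo (λ i → f (suc i)) n g)

  length-filter-∑∈ : ∀ {P : A → Set} (P? : ∀ x → Dec (P x)) xs →
                  + length (filter P? xs) ≡ ∑[ x ∈ xs ] (if does (P? x) then 1ℤ else 0ℤ)
  length-filter-∑∈ P? []       = refl
  length-filter-∑∈ P? (x ∷ xs) with does (P? x)
  ... | true  = cong (_+_ 1ℤ) (length-filter-∑∈ P? xs)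
  ... | false = trans (length-filter-∑∈ P? xs) (sym (+-identityˡ _))

module StateSums where
  open Automaton
  open Sums
  open import Data.Nat.Base as ℕ using (_<_; _≤_; _∸_; z≤n; s≤s)
  open import Data.Nat.Properties
    using (_≟_; n≮n; <-≤-trans; m≤m+n; m<m+n; +-monoʳ-<; m+[n∸m]≡n; +-∸-assoc; ≤pred⇒≤; m≤n⇒m≤1+n)
    renaming (+-identityʳ to ℕ-+-identityʳ)
  open import Data.Integer.Base using (ℤ; +_; 0ℤ; 1ℤ; _+_; _*_)
  open import Data.Integer.Properties using (+-assoc; +-identityˡ; *-identityʳ; *-zeroʳ; *-distribˡ-+)
  open import Data.List.Base using (upTo)
  open import Data.List.Membership.Propositional using (_∈_)
  open import Data.Bool.Base using (if_then_else_)
  open ≡-Reasoning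

  total : ℕ → (State → ℤ) → ℤ
  total n φ = ∑[ s ∈ invSeqs n ] φ (state s)

  total-cong : ∀ n {φ ψ} → (∀ σ → Bounded n σ → φ σ ≡ ψ σ) → total n φ ≡ total n ψ
  total-cong n eq = ∑∈-cong (invSeqs n) (λ s s∈ → eq (state s) (proj₁ (reachable n s∈)))

  total-distrib-+ : ∀ n φ ψ → total n (λ σ → φ σ + ψ σ) ≡ total n φ + total n ψ
  total-distrib-+ n φ ψ = ∑∈-distrib-+ (invSeqs n) _ _

  *-distribˡ-total : ∀ n c φ → c * total n φ ≡ total n (λ σ → c * φ σ)
  *-distribˡ-total n c φ = *-distribˡ-∑∈ (invSeqs n) c _

  total-zero : ∀ n → total n (λ _ → 0ℤ) ≡ 0ℤ
  total-zero n = ∑∈-zero (invSeqs n)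

  I≡total-alive : ∀ n → + I n ≡ total n (λ σ → if alive σ then 1ℤ else 0ℤ)
  I≡total-alive n = trans (length-filter-∑∈ avoidsAll? (invSeqs n)) (∑∈-cong (invSeqs n) λ s s∈ →
    cong (λ b → if b then 1ℤ else 0ℤ) (avoids?≡alive (state s) (proj₂ (reachable n s∈))))

  transfer : (State → ℤ) → ℕ → State → ℤ
  transfer φ n (ascending M m) =
    ∑[ a < m ] φ (locked a) + ∑[ i < M ∸ m ] φ (descended M (m ℕ.+ i)) + φ (ascending M m)
      + ∑[ i < n ∸ M ] φ (ascending (M ℕ.+ suc i) M)
  transfer φ n (descended M x) = φ (descended M x) + φ (descended M x)
  transfer φ n (locked x)      = φ (locked x)
  transfer φ n dead            = 0ℤ

  ∑-step-ascending : ∀ (φ : State → ℤ) n {M m} → M ≤ ℕ.pred n → m ≤ M →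
                     ∑[ a < suc n ] φ (step (ascending M m) a) ≡ transfer φ n (ascending M m)
  ∑-step-ascending φ n {M} {m} M≤ m≤M = begin
    ∑ (suc n) f
      ≡⟨ ∑-split-at f (m≤n⇒m≤1+n M≤n) ⟩
    ∑ M f + ∑[ i < suc n ∸ M ] f (M ℕ.+ i)
      ≡⟨ cong₂ _+_ (∑-split-at f m≤M) (cong (λ k → ∑[ i < k ] f (M ℕ.+ i)) (+-∸-assoc 1 M≤n)) ⟩
    ∑ m f + ∑[ i < M ∸ m ] f (m ℕ.+ i) + (f (M ℕ.+ 0) + ∑[ i < n ∸ M ] f (M ℕ.+ suc i))
      ≡⟨ cong₂ _+_ (cong₂ _+_ below between) (cong₂ _+_ at-max above) ⟩
    to-locked + to-descended + (unchanged + to-ascending)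
      ≡⟨ +-assoc (to-locked + to-descended) unchanged to-ascending ⟨
    to-locked + to-descended + unchanged + to-ascending
      ∎
    where
    f : ℕ → ℤ
    f a = φ (step (ascending M m) a)
    M≤n = ≤pred⇒≤ M≤
    to-locked    = ∑[ a < m ] φ (locked a)
    to-descended = ∑[ i < M ∸ m ] φ (descended M (m ℕ.+ i))
    unchanged    = φ (ascending M m)
    to-ascending = ∑[ i < n ∸ M ] φ (ascending (M ℕ.+ suc i) M)
    below : ∑ m f ≡ to-locked
    below = ∑-cong m (λ a a<m → cong φ (step-below-second a<m m≤M))
    between : ∑[ i < M ∸ m ] f (m ℕ.+ i) ≡ to-descended
    between = ∑-cong (M ∸ m) (λ i i<M∸m → cong φ (step-between (m≤m+n m i)
                (subst (m ℕ.+ i <_) (m+[n∸m]≡n m≤M) (+-monoʳ-< m i<M∸m))))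
    at-max : f (M ℕ.+ 0) ≡ unchanged
    at-max = trans (cong f (ℕ-+-identityʳ M)) (cong φ (step-max M m))
    above : ∑[ i < n ∸ M ] f (M ℕ.+ suc i) ≡ to-ascending
    above = ∑-cong (n ∸ M) (λ i _ → cong φ (step-above (m<m+n M (s≤s z≤n))))

  ∑-step-descended : ∀ (φ : State → ℤ) n {M x} → φ dead ≡ 0ℤ → x < M → M ≤ n →
                     ∑[ a < suc n ] φ (step (descended M x) a) ≡ φ (descended M x) + φ (descended M x)
  ∑-step-descended φ n {M} {x} φ-dead x<M M≤n = begin
    ∑[ a < suc n ] φ (step (descended M x) a)
      ≡⟨ ∑-cong (suc n) (λ a _ → pointwise a) ⟩
    ∑[ a < suc n ] (c * (⟦ M ≡ a ⟧ + ⟦ x ≡ a ⟧))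
      ≡⟨ *-distribˡ-∑ (suc n) c (λ a → ⟦ M ≡ a ⟧ + ⟦ x ≡ a ⟧) ⟨
    c * ∑[ a < suc n ] (⟦ M ≡ a ⟧ + ⟦ x ≡ a ⟧)
      ≡⟨ cong (c *_) (∑-distrib-+ (suc n) ⟦ M ≡_⟧ ⟦ x ≡_⟧) ⟩
    c * (∑[ a < suc n ] ⟦ M ≡ a ⟧ + ∑[ a < suc n ] ⟦ x ≡ a ⟧)
      ≡⟨ cong (c *_) (cong₂ _+_ (occurs (s≤s M≤n)) (occurs (m≤n⇒m≤1+n (<-≤-trans x<M M≤n)))) ⟩
    c * (1ℤ + 1ℤ)
      ≡⟨ *-distribˡ-+ c 1ℤ 1ℤ ⟩
    c * 1ℤ + c * 1ℤ
      ≡⟨ cong₂ _+_ (*-identityʳ c) (*-identityʳ c) ⟩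
    c + c
      ∎
    where
    c = φ (descended M x)
    occurs : ∀ {p} → p < suc n → ∑[ a < suc n ] ⟦ p ≡ a ⟧ ≡ 1ℤ
    occurs {p} p<1+n = trans (∑-⟦≡⟧ p (suc n)) (⟦≤⟧-yes p<1+n)
    pointwise : ∀ a → φ (step (descended M x) a) ≡ c * (⟦ M ≡ a ⟧ + ⟦ x ≡ a ⟧)
    pointwise a with a ≟ M | a ≟ x
    ... | yes refl | yes refl = ⊥-elim (n≮n _ x<M)
    ... | yes refl | no a≢x   rewrite ⟦≡⟧-refl a | ⟦≡⟧-no (≢-sym a≢x) = sym (*-identityʳ c)
    ... | no a≢M   | yes refl rewrite ⟦≡⟧-refl a | ⟦≡⟧-no (≢-sym a≢M) = sym (*-identityʳ c)
    ... | no a≢M   | no a≢x   rewrite ⟦≡⟧-no (≢-sym a≢M) | ⟦≡⟧-no (≢-sym a≢x) = trans φ-dead (sym (*-zeroʳ c))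

  ∑-step-locked : ∀ (φ : State → ℤ) n {x} → φ dead ≡ 0ℤ → x ≤ n → ∑[ a < suc n ] φ (step (locked x) a) ≡ φ (locked x)
  ∑-step-locked φ n {x} φ-dead x≤n =
    trans (∑-cong (suc n) (λ a _ → pointwise a)) (∑-point (suc n) x c (s≤s x≤n))
    where
    c = φ (locked x)
    pointwise : ∀ a → φ (step (locked x) a) ≡ c * ⟦ x ≡ a ⟧
    pointwise a with a ≟ x
    ... | yes refl rewrite ⟦≡⟧-refl a = sym (*-identityʳ c)
    ... | no a≢x   rewrite ⟦≡⟧-no (≢-sym a≢x) = trans φ-dead (sym (*-zeroʳ c))

  ∑-step : ∀ φ n σ → φ dead ≡ 0ℤ → Bounded n σ → ∑[ a < suc n ] φ (step σ a) ≡ transfer φ n σ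
  ∑-step φ n (ascending M m) _      (M≤ , m≤M) = ∑-step-ascending φ n M≤ m≤M
  ∑-step φ n (descended M x) φ-dead (x<M , M≤n) = ∑-step-descended φ n φ-dead x<M M≤n
  ∑-step φ n (locked x)      φ-dead x≤n        = ∑-step-locked φ n φ-dead x≤n
  ∑-step φ n dead            φ-dead _          = trans (∑-cong (suc n) (λ _ _ → φ-dead)) (∑-zero (suc n))

  total-suc : ∀ n φ → φ dead ≡ 0ℤ → total (suc n) φ ≡ total n (transfer φ n)
  total-suc n φ φ-dead = begin
    total (suc n) φ
      ≡⟨ ∑∈-concatMap (λ s → map (s ∷ʳ_) (upTo (suc n))) (invSeqs n) (λ t → φ (state t)) ⟩
    ∑[ s ∈ invSeqs n ] ∑[ t ∈ map (s ∷ʳ_) (upTo (suc n)) ] φ (state t)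
      ≡⟨ ∑∈-cong (invSeqs n) extensions ⟩
    total n (transfer φ n)
      ∎
    where
    extensions : ∀ s → s ∈ invSeqs n →
                 ∑[ t ∈ map (s ∷ʳ_) (upTo (suc n)) ] φ (state t) ≡ transfer φ n (state s)
    extensions s s∈ = begin
      ∑[ t ∈ map (s ∷ʳ_) (upTo (suc n)) ] φ (state t)
        ≡⟨ ∑∈-map (s ∷ʳ_) (upTo (suc n)) (λ t → φ (state t)) ⟩
      ∑[ a ∈ upTo (suc n) ] φ (state (s ∷ʳ a))
        ≡⟨ ∑∈-applyUpTo (λ a → a) (suc n) (λ a → φ (state (s ∷ʳ a))) ⟩
      ∑[ a < suc n ] φ (state (s ∷ʳ a))
        ≡⟨ ∑-cong (suc n) (λ a _ → cong φ (state-∷ʳ s a)) ⟩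
      ∑[ a < suc n ] φ (step (state s) a)
        ≡⟨ ∑-step φ n (state s) φ-dead (proj₁ (reachable n s∈)) ⟩
      transfer φ n (state s)
        ∎

  onAscending : (ℕ → ℕ → ℤ) → State → ℤ
  onAscending f (ascending M m) = f M m
  onAscending f _               = 0ℤ

  total-suc-onAscending : ∀ n f → total (suc n) (onAscending f) ≡
    total n (onAscending (λ M m → f M m + ∑[ i < n ∸ M ] f (M ℕ.+ suc i) M))
  total-suc-onAscending n f = trans (total-suc n (onAscending f) refl) (total-cong n pointwise)
    where
    pointwise : ∀ σ → Bounded n σ → transfer (onAscending f) n σ ≡
                onAscending (λ M m → f M m + ∑[ i < n ∸ M ] f (M ℕ.+ suc i) M) σ
    pointwise (ascending M m) _ = cong (_+ _) (trans
      (cong₂ (λ a b → a + b + f M m) (∑-zero m) (∑-zero (M ∸ m))) (+-identityˡ (f M m)))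
    pointwise (descended M x) _ = refl
    pointwise (locked x)      _ = refl
    pointwise dead            _ = refl

  total-onAscending-cong : ∀ n {f g} → (∀ M m → M ≤ ℕ.pred n → f M m ≡ g M m) →
                           total n (onAscending f) ≡ total n (onAscending g)
  total-onAscending-cong n eq = total-cong n pointwise
    where
    pointwise : ∀ σ → Bounded n σ → onAscending _ σ ≡ onAscending _ σ
    pointwise (ascending M m) (M≤ , _) = eq M m M≤
    pointwise (descended M x) _        = refl
    pointwise (locked x)      _        = refl
    pointwise dead            _        = refl

  total-onAscending-+ : ∀ n f g → total n (onAscending (λ M m → f M m + g M m)) ≡
                        total n (onAscending f) + total n (onAscending g)
  total-onAscending-+ n f g = trans (total-cong n pointwise) (total-distrib-+ n (onAscending f) (onAscending g))
    where
    pointwise : ∀ σ → Bounded n σ → onAscending (λ M m → f M m + g M m) σ ≡ onAscending f σ + onAscending g σ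
    pointwise (ascending M m) _ = refl
    pointwise (descended M x) _ = refl
    pointwise (locked x)      _ = refl
    pointwise dead            _ = refl

module Recurrences where
  open Automaton
  open Sums
  open StateSums
  open import Data.Nat.Base as ℕ using (_<_; _≤_; _∸_)
  open import Data.Nat.Properties
    using (+-suc; ∸-+-assoc; m+n∸m≡n; +-∸-assoc; m+[n∸m]≡n; m∸n≤m; ≤-<-trans; ≤pred⇒≤)
  open import Data.Integer.Base using (ℤ; +_; 0ℤ; 1ℤ; _+_; _*_; _-_)
  open import Data.Integer.Properties using (*-identityʳ; *-zeroʳ; pos-*)
  open import Data.Integer.Tactic.RingSolver using (solve-∀)
  import Data.Nat.Tactic.RingSolver as ℕ-Solver
  open import Data.Bool.Base using (if_then_else_)
  open ≡-Reasoning

  isDescended : State → ℤ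
  isDescended (descended _ _) = 1ℤ
  isDescended _               = 0ℤ

  isLocked : State → ℤ
  isLocked (locked _) = 1ℤ
  isLocked _          = 0ℤ

  isAscending gapWeight secondWeight : State → ℤ
  isAscending  = onAscending (λ M m → 1ℤ)
  gapWeight    = onAscending (λ M m → + (M ∸ m))
  secondWeight = onAscending (λ M m → + m)

  A D L gap second slack slackTriangle slackMax : ℕ → ℤ
  A n             = total n isAscending
  D n             = total n isDescended
  L n             = total n isLocked
  gap n           = total n gapWeight
  second n        = total n secondWeight
  slack n         = total n (onAscending (λ M m → + (n ∸ M)))
  slackTriangle n = total n (onAscending (λ M m → triangle (n ∸ M)))
  slackMax n      = total n (onAscending (λ M m → + (n ∸ M) * + M))

  ballot : ℕ → ℕ → ℤ
  ballot n y = total n (onAscending (λ M m → ⟦ y ≤ n ∸ M ⟧))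

  suc∸+suc : ∀ n M i → suc n ∸ (M ℕ.+ suc i) ≡ n ∸ M ∸ i
  suc∸+suc n M i = trans (cong (suc n ∸_) (+-suc M i)) (sym (∸-+-assoc n M i))

  I≡A+D+L : ∀ n → + I n ≡ A n + D n + L n
  I≡A+D+L n = begin
    + I n
      ≡⟨ I≡total-alive n ⟩
    total n (λ σ → if alive σ then 1ℤ else 0ℤ)
      ≡⟨ total-cong n pointwise ⟩
    total n (λ σ → isAscending σ + isDescended σ + isLocked σ)
      ≡⟨ total-distrib-+ n (λ σ → isAscending σ + isDescended σ) isLocked ⟩
    total n (λ σ → isAscending σ + isDescended σ) + L n
      ≡⟨ cong (λ t → t + L n) (total-distrib-+ n isAscending isDescended) ⟩
    A n + D n + L n
      ∎
    where
    pointwise : ∀ σ → Bounded n σ →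
                (if alive σ then 1ℤ else 0ℤ) ≡ isAscending σ + isDescended σ + isLocked σ
    pointwise (ascending _ _) _ = refl
    pointwise (descended _ _) _ = refl
    pointwise (locked _)      _ = refl
    pointwise dead            _ = refl

  D-suc : ∀ n → D (suc n) ≡ + 2 * D n + gap n
  D-suc n = begin
    D (suc n)
      ≡⟨ total-suc n isDescended refl ⟩
    total n (transfer isDescended n)
      ≡⟨ total-cong n pointwise ⟩
    total n (λ σ → + 2 * isDescended σ + gapWeight σ)
      ≡⟨ total-distrib-+ n (λ σ → + 2 * isDescended σ) gapWeight ⟩
    total n (λ σ → + 2 * isDescended σ) + gap n
      ≡⟨ cong (λ t → t + gap n) (*-distribˡ-total n (+ 2) isDescended) ⟨
    + 2 * D n + gap n
      ∎
    where
    pointwise : ∀ σ → Bounded n σ → transfer isDescended n σ ≡ + 2 * isDescended σ + gapWeight σ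
    pointwise (ascending M m) _ rewrite ∑-zero m | ∑-const (M ∸ m) 1ℤ | ∑-zero (n ∸ M) = lemma (+ (M ∸ m))
      where
      lemma : ∀ k → 0ℤ + k * 1ℤ + 0ℤ + 0ℤ ≡ + 2 * 0ℤ + k
      lemma = solve-∀
    pointwise (descended _ _) _ = refl
    pointwise (locked _)      _ = refl
    pointwise dead            _ = refl

  L-suc : ∀ n → L (suc n) ≡ L n + second n
  L-suc n = begin
    L (suc n)                                    ≡⟨ total-suc n isLocked refl ⟩
    total n (transfer isLocked n)                ≡⟨ total-cong n pointwise ⟩
    total n (λ σ → isLocked σ + secondWeight σ)  ≡⟨ total-distrib-+ n isLocked secondWeight ⟩
    L n + second n                               ∎
    where
    pointwise : ∀ σ → Bounded n σ → transfer isLocked n σ ≡ isLocked σ + secondWeight σ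
    pointwise (ascending M m) _ rewrite ∑-const m 1ℤ | ∑-zero (M ∸ m) | ∑-zero (n ∸ M) = lemma (+ m)
      where
      lemma : ∀ k → k * 1ℤ + 0ℤ + 0ℤ + 0ℤ ≡ 0ℤ + k
      lemma = solve-∀
    pointwise (descended _ _) _ = refl
    pointwise (locked _)      _ = refl
    pointwise dead            _ = refl

  A-suc : ∀ n → A (suc n) ≡ A n + slack n
  A-suc n = begin
    A (suc n)                                                   ≡⟨ total-suc-onAscending n (λ M m → 1ℤ) ⟩
    total n (onAscending (λ M m → 1ℤ + ∑[ i < n ∸ M ] 1ℤ))      ≡⟨ total-onAscending-cong n pointwise ⟩
    total n (onAscending (λ M m → 1ℤ + + (n ∸ M)))              ≡⟨ total-onAscending-+ n _ _ ⟩
    A n + slack n                                               ∎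
    where
    pointwise : ∀ M m → M ≤ ℕ.pred n → 1ℤ + ∑[ i < n ∸ M ] 1ℤ ≡ 1ℤ + + (n ∸ M)
    pointwise M m _ = cong (_+_ 1ℤ) (trans (∑-const (n ∸ M) 1ℤ) (*-identityʳ (+ (n ∸ M))))

  slack-suc : ∀ n → slack (suc n) ≡ A n + slack n + slackTriangle n
  slack-suc n = begin
    slack (suc n)
      ≡⟨ total-suc-onAscending n (λ M m → + (suc n ∸ M)) ⟩
    total n (onAscending (λ M m → + (suc n ∸ M) + ∑[ i < n ∸ M ] (+ (suc n ∸ (M ℕ.+ suc i)))))
      ≡⟨ total-onAscending-cong n pointwise ⟩
    total n (onAscending (λ M m → 1ℤ + + (n ∸ M) + triangle (n ∸ M)))
      ≡⟨ total-onAscending-+ n _ _ ⟩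
    total n (onAscending (λ M m → 1ℤ + + (n ∸ M))) + slackTriangle n
      ≡⟨ cong (λ t → t + slackTriangle n) (total-onAscending-+ n _ _) ⟩
    A n + slack n + slackTriangle n
      ∎
    where
    pointwise : ∀ M m → M ≤ ℕ.pred n →
      + (suc n ∸ M) + ∑[ i < n ∸ M ] (+ (suc n ∸ (M ℕ.+ suc i))) ≡ 1ℤ + + (n ∸ M) + triangle (n ∸ M)
    pointwise M m M≤ = cong₂ _+_ (cong +_ (+-∸-assoc 1 (≤pred⇒≤ M≤))) (begin
      ∑[ i < n ∸ M ] (+ (suc n ∸ (M ℕ.+ suc i))) ≡⟨ ∑-cong (n ∸ M) (λ i _ → cong +_ (suc∸+suc n M i)) ⟩
      ∑[ i < n ∸ M ] (+ (n ∸ M ∸ i))             ≡⟨ ∑-countdown (n ∸ M) (λ k → + k) ⟩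
      triangle (n ∸ M)                           ∎)

  gap-suc : ∀ n → gap (suc n) ≡ gap n + slackTriangle n
  gap-suc n = begin
    gap (suc n)
      ≡⟨ total-suc-onAscending n (λ M m → + (M ∸ m)) ⟩
    total n (onAscending (λ M m → + (M ∸ m) + ∑[ i < n ∸ M ] (+ (M ℕ.+ suc i ∸ M))))
      ≡⟨ total-onAscending-cong n (λ M m _ → cong (_+_ (+ (M ∸ m)))
           (∑-cong (n ∸ M) (λ i _ → cong +_ (m+n∸m≡n M (suc i))))) ⟩
    total n (onAscending (λ M m → + (M ∸ m) + triangle (n ∸ M)))
      ≡⟨ total-onAscending-+ n _ _ ⟩
    gap n + slackTriangle n
      ∎

  second-suc : ∀ n → second (suc n) ≡ second n + slackMax n
  second-suc n = begin
    second (suc n)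
      ≡⟨ total-suc-onAscending n (λ M m → + m) ⟩
    total n (onAscending (λ M m → + m + ∑[ i < n ∸ M ] (+ M)))
      ≡⟨ total-onAscending-cong n (λ M m _ → cong (_+_ (+ m)) (∑-const (n ∸ M) (+ M))) ⟩
    total n (onAscending (λ M m → + m + + (n ∸ M) * + M))
      ≡⟨ total-onAscending-+ n _ _ ⟩
    second n + slackMax n
      ∎

  slackMax+2*slackTriangle : ∀ n → slackMax n + + 2 * slackTriangle n ≡ + suc n * slack n
  slackMax+2*slackTriangle n = begin
    slackMax n + + 2 * slackTriangle n
      ≡⟨ cong (_+_ (slackMax n)) (*-distribˡ-total n (+ 2) (onAscending (λ M m → triangle (n ∸ M)))) ⟩
    slackMax n + total n (λ σ → + 2 * onAscending (λ M m → triangle (n ∸ M)) σ)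
      ≡⟨ total-distrib-+ n (onAscending (λ M m → + (n ∸ M) * + M))
                           (λ σ → + 2 * onAscending (λ M m → triangle (n ∸ M)) σ) ⟨
    total n (λ σ → onAscending (λ M m → + (n ∸ M) * + M) σ + + 2 * onAscending (λ M m → triangle (n ∸ M)) σ)
      ≡⟨ total-cong n pointwise ⟩
    total n (λ σ → + suc n * onAscending (λ M m → + (n ∸ M)) σ)
      ≡⟨ *-distribˡ-total n (+ suc n) (onAscending (λ M m → + (n ∸ M))) ⟨
    + suc n * slack n
      ∎
    where
    pointwise : ∀ σ → Bounded n σ →
      onAscending (λ M m → + (n ∸ M) * + M) σ + + 2 * onAscending (λ M m → triangle (n ∸ M)) σ ≡
      + suc n * onAscending (λ M m → + (n ∸ M)) σ
    pointwise (ascending M m) (M≤ , _) = begin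
      + x * + M + + 2 * triangle x   ≡⟨ cong₂ _+_ (sym (pos-* x M)) (triangle-double x) ⟩
      + (x ℕ.* M ℕ.+ x ℕ.* suc x)    ≡⟨ cong +_ (lemma M x) ⟩
      + (suc (M ℕ.+ x) ℕ.* x)        ≡⟨ cong (λ k → + (suc k ℕ.* x)) (m+[n∸m]≡n (≤pred⇒≤ M≤)) ⟩
      + (suc n ℕ.* x)                ≡⟨ pos-* (suc n) x ⟩
      + suc n * + x                  ∎
      where
      x = n ∸ M
      lemma : ∀ M x → x ℕ.* M ℕ.+ x ℕ.* suc x ≡ suc (M ℕ.+ x) ℕ.* x
      lemma = ℕ-Solver.solve-∀
    pointwise (descended _ _) _ = sym (*-zeroʳ (+ suc n))
    pointwise (locked _)      _ = sym (*-zeroʳ (+ suc n))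
    pointwise dead            _ = sym (*-zeroʳ (+ suc n))

  ballot-suc : ∀ n y → ballot (suc n) (suc y) ≡ ballot n y + ballot (suc n) (suc (suc y))
  ballot-suc n y = begin
    ballot (suc n) (suc y)
      ≡⟨ total-onAscending-cong (suc n) (λ M m _ → ⟦≤⟧-split (suc y) (suc n ∸ M)) ⟩
    total (suc n) (onAscending (λ M m → ⟦ suc y ≡ suc n ∸ M ⟧ + ⟦ suc (suc y) ≤ suc n ∸ M ⟧))
      ≡⟨ total-onAscending-+ (suc n) _ _ ⟩
    total (suc n) (onAscending (λ M m → ⟦ suc y ≡ suc n ∸ M ⟧)) + ballot (suc n) (suc (suc y))
      ≡⟨ cong (λ t → t + ballot (suc n) (suc (suc y))) last-entry ⟩
    ballot n y + ballot (suc n) (suc (suc y))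
      ∎
    where
    pointwise : ∀ M m → M ≤ ℕ.pred n →
      ⟦ suc y ≡ suc n ∸ M ⟧ + ∑[ i < n ∸ M ] ⟦ suc y ≡ suc n ∸ (M ℕ.+ suc i) ⟧ ≡ ⟦ y ≤ n ∸ M ⟧
    pointwise M m M≤ = begin
      ⟦ suc y ≡ suc n ∸ M ⟧ + ∑[ i < n ∸ M ] ⟦ suc y ≡ suc n ∸ (M ℕ.+ suc i) ⟧
        ≡⟨ cong₂ _+_ (cong ⟦ suc y ≡_⟧ (+-∸-assoc 1 (≤pred⇒≤ M≤)))
                     (∑-cong (n ∸ M) (λ i _ → cong ⟦ suc y ≡_⟧ (suc∸+suc n M i))) ⟩
      ⟦ y ≡ n ∸ M ⟧ + ∑[ i < n ∸ M ] ⟦ suc y ≡ n ∸ M ∸ i ⟧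
        ≡⟨ cong (_+_ ⟦ y ≡ n ∸ M ⟧) (trans (∑-countdown (n ∸ M) ⟦ suc y ≡_⟧) (∑-⟦≡⟧ y (n ∸ M))) ⟩
      ⟦ y ≡ n ∸ M ⟧ + ⟦ suc y ≤ n ∸ M ⟧
        ≡⟨ ⟦≤⟧-split y (n ∸ M) ⟨
      ⟦ y ≤ n ∸ M ⟧
        ∎
    last-entry : total (suc n) (onAscending (λ M m → ⟦ suc y ≡ suc n ∸ M ⟧)) ≡ ballot n y
    last-entry = trans (total-suc-onAscending n _) (total-onAscending-cong n pointwise)

  ballot-0≡1 : ∀ n → ballot (suc n) 0 ≡ ballot (suc n) 1
  ballot-0≡1 n = total-onAscending-cong (suc n) (λ M m M≤n → cong ⟦ 1 ≤_⟧ (sym (+-∸-assoc 1 M≤n)))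

  ballot-vanishes : ∀ n y → suc n < y → ballot (suc n) y ≡ 0ℤ
  ballot-vanishes n y n+1<y = trans (total-cong (suc n) pointwise) (total-zero (suc n))
    where
    pointwise : ∀ σ → Bounded (suc n) σ → onAscending (λ M m → ⟦ y ≤ suc n ∸ M ⟧) σ ≡ 0ℤ
    pointwise (ascending M m) _ = ⟦≤⟧-no (≤-<-trans (m∸n≤m (suc n) M) n+1<y)
    pointwise (descended _ _) _ = refl
    pointwise (locked _)      _ = refl
    pointwise dead            _ = refl

  slack≡ΔA : ∀ n → slack n ≡ A (suc n) - A n
  slack≡ΔA n = solve-for (A-suc n)
    where
    solve-for : ∀ {a a′ x} → a′ ≡ a + x → x ≡ a′ - a
    solve-for {a} {x = x} refl = lemma a x
      where
      lemma : ∀ a x → x ≡ a + x - a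
      lemma = solve-∀

  slackTriangle≡Δ²A : ∀ n → slackTriangle n ≡ A (suc (suc n)) - + 2 * A (suc n)
  slackTriangle≡Δ²A n = begin
    slackTriangle n
      ≡⟨ isolate (A n) (slack n) (slackTriangle n) ⟩
    A n + slack n + slackTriangle n - A n - slack n
      ≡⟨ cong (λ s → s - A n - slack n) (slack-suc n) ⟨
    slack (suc n) - A n - slack n
      ≡⟨ cong₂ (λ s t → s - A n - t) (slack≡ΔA (suc n)) (slack≡ΔA n) ⟩
    A (suc (suc n)) - A (suc n) - A n - (A (suc n) - A n)
      ≡⟨ collect (A n) (A (suc n)) (A (suc (suc n))) ⟩
    A (suc (suc n)) - + 2 * A (suc n)
      ∎
    where
    isolate : ∀ a s t → t ≡ a + s + t - a - s
    isolate = solve-∀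
    collect : ∀ a₀ a₁ a₂ → a₂ - a₁ - a₀ - (a₁ - a₀) ≡ a₂ - + 2 * a₁
    collect = solve-∀

  scaledΔA : ℕ → ℤ
  scaledΔA n = + suc n * (A (suc n) - A n)

  gap-suc-Δ²A : ∀ n → gap (suc n) ≡ gap n + (A (suc (suc n)) - + 2 * A (suc n))
  gap-suc-Δ²A n = trans (gap-suc n) (cong (_+_ (gap n)) (slackTriangle≡Δ²A n))

  second-suc-Δ²A : ∀ n → second (suc n) ≡ second n + scaledΔA n - + 2 * (A (suc (suc n)) - + 2 * A (suc n))
  second-suc-Δ²A n = begin
    second (suc n)
      ≡⟨ second-suc n ⟩
    second n + slackMax n
      ≡⟨ shift (second n) (slackMax n) (slackTriangle n) slackMax+2T≡scaledΔA ⟩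
    second n + scaledΔA n - + 2 * slackTriangle n
      ≡⟨ cong (λ t → second n + scaledΔA n - + 2 * t) (slackTriangle≡Δ²A n) ⟩
    second n + scaledΔA n - + 2 * (A (suc (suc n)) - + 2 * A (suc n))
      ∎
    where
    slackMax+2T≡scaledΔA : slackMax n + + 2 * slackTriangle n ≡ scaledΔA n
    slackMax+2T≡scaledΔA = trans (slackMax+2*slackTriangle n) (cong (+ suc n *_) (slack≡ΔA n))
    shift : ∀ r m t {x} → m + + 2 * t ≡ x → r + m ≡ r + x - + 2 * t
    shift r m t refl = lemma r m t
      where
      lemma : ∀ r m t → r + m ≡ r + (m + + 2 * t) - + 2 * t
      lemma = solve-∀

module Binomials where
  open import Data.Nat.Base using (_≤_; _*_; _+_; _∸_; z≤n; s≤s)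
  open import Data.Nat.Properties using (*-distribˡ-+; *-zeroʳ; *-comm; +-assoc; +-comm; +-suc; m+n∸n≡m; ≤-trans; n≤1+n)
  open import Data.Nat.Combinatorics using (_C_; nCk+nC[k+1]≡[n+1]C[k+1]; nCk≡nC[n∸k]; nC1≡n)
  open import Data.Nat.Tactic.RingSolver using (solve-∀)
  open ≡-Reasoning

  pascal : ∀ m k → suc m C suc k ≡ m C k + m C suc k
  pascal m k = sym (nCk+nC[k+1]≡[n+1]C[k+1] m k)

  absorption : ∀ m k → suc k * (suc m C suc k) ≡ suc m * (m C k)
  absorption zero    zero    = refl
  absorption zero    (suc k) = *-zeroʳ (suc (suc k))
  absorption (suc m) zero    = begin
    1 * (suc (suc m) C 1)   ≡⟨ cong (1 *_) (nC1≡n (suc (suc m))) ⟩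
    1 * suc (suc m)         ≡⟨ *-comm 1 (suc (suc m)) ⟩
    suc (suc m) * 1         ∎
  absorption (suc m) (suc k) = begin
    suc (suc k) * (suc (suc m) C suc (suc k))
      ≡⟨ cong (suc (suc k) *_) (pascal (suc m) (suc k)) ⟩
    suc (suc k) * (suc m C suc k + suc m C suc (suc k))
      ≡⟨ *-distribˡ-+ (suc (suc k)) (suc m C suc k) (suc m C suc (suc k)) ⟩
    suc (suc k) * (suc m C suc k) + suc (suc k) * (suc m C suc (suc k))
      ≡⟨ cong (suc (suc k) * (suc m C suc k) +_) (absorption m (suc k)) ⟩
    (suc m C suc k + suc k * (suc m C suc k)) + suc m * (m C suc k)
      ≡⟨ cong (λ t → (suc m C suc k + t) + suc m * (m C suc k)) (absorption m k) ⟩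
    (suc m C suc k + suc m * (m C k)) + suc m * (m C suc k)
      ≡⟨ +-assoc (suc m C suc k) (suc m * (m C k)) (suc m * (m C suc k)) ⟩
    suc m C suc k + (suc m * (m C k) + suc m * (m C suc k))
      ≡⟨ cong (suc m C suc k +_) (*-distribˡ-+ (suc m) (m C k) (m C suc k)) ⟨
    suc m C suc k + suc m * (m C k + m C suc k)
      ≡⟨ cong (λ t → suc m C suc k + suc m * t) (pascal m k) ⟨
    suc (suc m) * (suc m C suc k)
      ∎

  absorption-sum : ∀ m k → suc k * (m C suc k) + suc k * (m C k) ≡ suc m * (m C k)
  absorption-sum m k = begin
    suc k * (m C suc k) + suc k * (m C k) ≡⟨ +-comm (suc k * (m C suc k)) (suc k * (m C k)) ⟩
    suc k * (m C k) + suc k * (m C suc k) ≡⟨ *-distribˡ-+ (suc k) (m C k) (m C suc k) ⟨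
    suc k * (m C k + m C suc k)           ≡⟨ cong (suc k *_) (pascal m k) ⟨
    suc k * (suc m C suc k)               ≡⟨ absorption m k ⟩
    suc m * (m C k)                       ∎

  twice : ℕ → ℕ
  twice zero    = zero
  twice (suc n) = suc (suc (twice n))

  twice≡+ : ∀ n → twice n ≡ n + n
  twice≡+ zero    = refl
  twice≡+ (suc n) = cong suc (trans (cong suc (twice≡+ n)) (sym (+-suc n n)))

  n≤twice : ∀ n → n ≤ twice n
  n≤twice zero    = z≤n
  n≤twice (suc n) = s≤s (≤-trans (n≤twice n) (n≤1+n (twice n)))

  central-symmetric : ∀ n → suc (twice n) C n ≡ suc (twice n) C suc n
  central-symmetric n = trans (nCk≡nC[n∸k] (≤-trans (n≤twice n) (n≤1+n (twice n))))
                             (cong (suc (twice n) C_) suc[twice]∸n)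
    where
    suc[twice]∸n : suc (twice n) ∸ n ≡ suc n
    suc[twice]∸n = trans (cong (λ k → suc k ∸ n) (twice≡+ n)) (m+n∸n≡m (suc n) n)

  central-ratio : ∀ n → suc (suc n) * (suc (twice (suc n)) C suc (suc n)) ≡
                      2 * suc (suc (suc (twice n))) * (suc (twice n) C suc n)
  central-ratio n = begin
    suc (suc n) * (suc (twice (suc n)) C suc (suc n))  ≡⟨ absorption (twice (suc n)) (suc n) ⟩
    suc (twice (suc n)) * (twice (suc n) C suc n)      ≡⟨ cong (suc (twice (suc n)) *_) (pascal (suc (twice n)) n) ⟩
    suc (twice (suc n)) * (suc (twice n) C n + β)      ≡⟨ cong (λ t → suc (twice (suc n)) * (t + β)) (central-symmetric n) ⟩
    suc (twice (suc n)) * (β + β)                      ≡⟨ lemma (suc (twice (suc n))) β ⟩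
    2 * suc (twice (suc n)) * β                        ∎
    where
    β = suc (twice n) C suc n
    lemma : ∀ a b → a * (b + b) ≡ 2 * a * b
    lemma = solve-∀

module Catalan where
  open Recurrences using (A; scaledΔA; ballot; ballot-suc; ballot-0≡1; ballot-vanishes)
  open Binomials
  open import Data.Nat.Base as ℕ using (_<_; s≤s)
  open import Data.Nat.Properties using (+-suc; suc-injective; +-identityʳ)
  open import Data.Nat.Combinatorics using (_C_)
  open import Data.Integer.Base using (+_; 0ℤ; _+_; _*_; _-_)
  open import Data.Integer.Properties using (pos-*; *-cancelˡ-≡; +-commutativeSemigroup; *-commutativeSemigroup)
  open import Algebra.Properties.CommutativeSemigroup +-commutativeSemigroup
    using (interchange) renaming (x∙yz≈y∙xz to x+[y+z]≡y+[x+z])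
  open import Algebra.Properties.CommutativeSemigroup *-commutativeSemigroup
    using () renaming (x∙yz≈y∙xz to x*[y*z]≡y*[x*z])
  open import Data.Integer.Tactic.RingSolver using (solve-∀)
  open ≡-Reasoning

  pascalℤ : ∀ m k → + (suc m C suc k) ≡ + (m C k) + + (m C suc k)
  pascalℤ m k = cong +_ (pascal m k)

  mutual
    ballot-formula : ∀ n y m → y ℕ.+ m ≡ twice n → ballot n y + + (m C suc n) ≡ + (m C n)
    ballot-formula zero    zero    zero    _    = refl
    ballot-formula (suc n) (suc y) m       e    = ballot-formula-suc n y m (suc-injective e)
    ballot-formula (suc n) zero    m       refl = begin
      ballot (suc n) 0 + + (twice (suc n) C suc (suc n)) ≡⟨ cong₂ _+_ (ballot-0≡1 n) (pascalℤ (suc (twice n)) (suc n)) ⟩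
      ballot (suc n) 1 + (+ β + + γ)                     ≡⟨ x+[y+z]≡y+[x+z] (ballot (suc n) 1) (+ β) (+ γ) ⟩
      + β + (ballot (suc n) 1 + + γ)                     ≡⟨ cong (_+_ (+ β)) (ballot-formula-suc n 0 (suc (twice n)) refl) ⟩
      + β + + β                                          ≡⟨ cong (λ t → + t + + β) (central-symmetric n) ⟨
      + (suc (twice n) C n) + + β                        ≡⟨ pascalℤ (suc (twice n)) n ⟨
      + (twice (suc n) C suc n)                          ∎
      where
      β = suc (twice n) C suc n
      γ = suc (twice n) C suc (suc n)

    ballot-formula-suc : ∀ n y m → y ℕ.+ m ≡ suc (twice n) →
                         ballot (suc n) (suc y) + + (m C suc (suc n)) ≡ + (m C suc n)
    ballot-formula-suc n y zero e = cong (λ b → b + 0ℤ) (ballot-vanishes n (suc y) (s≤s n<y))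
      where
      n<y : n < y
      n<y = subst (suc n ℕ.≤_) (trans (sym e) (+-identityʳ y)) (s≤s (n≤twice n))
    ballot-formula-suc n y (suc m) e = begin
      ballot (suc n) (suc y) + + (suc m C suc (suc n))
        ≡⟨ cong₂ _+_ (ballot-suc n y) (pascalℤ m (suc n)) ⟩
      ballot n y + ballot (suc n) (suc (suc y)) + (+ (m C suc n) + + (m C suc (suc n)))
        ≡⟨ interchange (ballot n y) _ _ _ ⟩
      ballot n y + + (m C suc n) + (ballot (suc n) (suc (suc y)) + + (m C suc (suc n)))
        ≡⟨ cong₂ _+_ (ballot-formula n y m (suc-injective (trans (sym (+-suc y m)) e)))
                     (ballot-formula-suc n (suc y) m (trans (sym (+-suc y m)) e)) ⟩
      + (m C n) + + (m C suc n)
        ≡⟨ pascalℤ m n ⟨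
      + (suc m C suc n)
        ∎

  catalan-difference : ∀ n → A (suc n) + + (suc (twice n) C suc (suc n)) ≡ + (suc (twice n) C suc n)
  catalan-difference n = trans (cong (λ a → a + + (suc (twice n) C suc (suc n))) (ballot-0≡1 n))
                           (ballot-formula-suc n 0 (suc (twice n)) refl)

  catalan-central : ∀ n → + suc (suc n) * A (suc n) ≡ + 2 * + (suc (twice n) C suc n)
  catalan-central n = solve-for-A (A (suc n)) (+ γ) (+ β) (+ n) (catalan-difference n) absorbed
    where
    β = suc (twice n) C suc n
    γ = suc (twice n) C suc (suc n)
    absorbed : (+ 2 + + n) * + γ + (+ 2 + + n) * + β ≡ (+ 2 + (+ n + + n)) * + β
    absorbed = begin
      + suc (suc n) * + γ + + suc (suc n) * + β
        ≡⟨ cong₂ _+_ (pos-* (suc (suc n)) γ) (pos-* (suc (suc n)) β) ⟨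
      + (suc (suc n) ℕ.* γ ℕ.+ suc (suc n) ℕ.* β)
        ≡⟨ cong +_ (absorption-sum (suc (twice n)) (suc n)) ⟩
      + (suc (suc (twice n)) ℕ.* β)
        ≡⟨ pos-* (suc (suc (twice n))) β ⟩
      + suc (suc (twice n)) * + β
        ≡⟨ cong (λ t → + (suc (suc t)) * + β) (twice≡+ n) ⟩
      (+ 2 + (+ n + + n)) * + β
        ∎
    solve-for-A : ∀ a g b N → a + g ≡ b → (+ 2 + N) * g + (+ 2 + N) * b ≡ (+ 2 + (N + N)) * b →
                  (+ 2 + N) * a ≡ + 2 * b
    solve-for-A a g b N a+g≡b weighted = begin
      (+ 2 + N) * a
        ≡⟨ expand a g b N ⟩
      (+ 2 + N) * (a + g) + (+ 2 + N) * b - ((+ 2 + N) * g + (+ 2 + N) * b)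
        ≡⟨ cong₂ (λ s t → (+ 2 + N) * s + (+ 2 + N) * b - t) a+g≡b weighted ⟩
      (+ 2 + N) * b + (+ 2 + N) * b - (+ 2 + (N + N)) * b
        ≡⟨ collect N b ⟩
      + 2 * b
        ∎
      where
      expand : ∀ a g b N → (+ 2 + N) * a ≡ (+ 2 + N) * (a + g) + (+ 2 + N) * b - ((+ 2 + N) * g + (+ 2 + N) * b)
      expand = solve-∀
      collect : ∀ N b → (+ 2 + N) * b + (+ 2 + N) * b - (+ 2 + (N + N)) * b ≡ + 2 * b
      collect = solve-∀

  catalan-recurrence : ∀ n → + suc (suc n) * A (suc n) ≡ (+ 4 * + n + + 2) * A n
  catalan-recurrence zero    = refl
  catalan-recurrence (suc n) = *-cancelˡ-≡ (+ suc (suc n)) _ _ (begin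
    + suc (suc n) * (+ suc (suc (suc n)) * A (suc (suc n)))
      ≡⟨ cong (+ suc (suc n) *_) (catalan-central (suc n)) ⟩
    + suc (suc n) * (+ 2 * + β′)
      ≡⟨ x*[y*z]≡y*[x*z] (+ suc (suc n)) (+ 2) (+ β′) ⟩
    + 2 * (+ suc (suc n) * + β′)
      ≡⟨ cong (+ 2 *_) (trans (sym (pos-* (suc (suc n)) β′)) (cong +_ (central-ratio n))) ⟩
    + 2 * + (2 ℕ.* suc (suc (suc (twice n))) ℕ.* β)
      ≡⟨ cong (+ 2 *_) central-ratio-cast ⟩
    + 2 * ((+ 2 * (+ 3 + (+ n + + n))) * + β)
      ≡⟨ regroup (+ n) (+ β) ⟩
    (+ 4 * (+ 1 + + n) + + 2) * (+ 2 * + β)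
      ≡⟨ cong ((+ 4 * (+ 1 + + n) + + 2) *_) (catalan-central n) ⟨
    (+ 4 * + suc n + + 2) * (+ suc (suc n) * A (suc n))
      ≡⟨ x*[y*z]≡y*[x*z] (+ 4 * + suc n + + 2) (+ suc (suc n)) (A (suc n)) ⟩
    + suc (suc n) * ((+ 4 * + suc n + + 2) * A (suc n))
      ∎)
    where
    β  = suc (twice n) C suc n
    β′ = suc (twice (suc n)) C suc (suc n)
    central-ratio-cast : + (2 ℕ.* suc (suc (suc (twice n))) ℕ.* β) ≡ (+ 2 * (+ 3 + (+ n + + n))) * + β
    central-ratio-cast = begin
      + (2 ℕ.* suc (suc (suc (twice n))) ℕ.* β)      ≡⟨ pos-* (2 ℕ.* suc (suc (suc (twice n)))) β ⟩
      + (2 ℕ.* suc (suc (suc (twice n)))) * + β      ≡⟨ cong (_* + β) (pos-* 2 (suc (suc (suc (twice n))))) ⟩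
      (+ 2 * + suc (suc (suc (twice n)))) * + β      ≡⟨ cong (λ t → (+ 2 * + suc (suc (suc t))) * + β) (twice≡+ n) ⟩
      (+ 2 * (+ 3 + (+ n + + n))) * + β              ∎
    regroup : ∀ N b → + 2 * ((+ 2 * (+ 3 + (N + N))) * b) ≡ (+ 4 * (+ 1 + N) + + 2) * (+ 2 * b)
    regroup = solve-∀

  scaledΔA-suc : ∀ n → scaledΔA (suc n) ≡ + 4 * scaledΔA n + + 2 * A (suc n) - A (suc (suc n)) + + 2 * A n
  scaledΔA-suc n = lemma (+ n) (A n) (A (suc n)) (A (suc (suc n))) (catalan-recurrence n) (catalan-recurrence (suc n))
    where
    lemma : ∀ N a₀ a₁ a₂ → (+ 2 + N) * a₁ ≡ (+ 4 * N + + 2) * a₀ →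
            (+ 3 + N) * a₂ ≡ (+ 4 * (+ 1 + N) + + 2) * a₁ →
            (+ 2 + N) * (a₂ - a₁) ≡ + 4 * ((+ 1 + N) * (a₁ - a₀)) + + 2 * a₁ - a₂ + + 2 * a₀
    lemma N a₀ a₁ a₂ h₁ h₂ = begin
      (+ 2 + N) * (a₂ - a₁)                                    ≡⟨ expand N a₁ a₂ ⟩
      (+ 3 + N) * a₂ - (+ 2 + N) * a₁ - a₂                     ≡⟨ cong₂ (λ u v → u - v - a₂) h₂ h₁ ⟩
      (+ 4 * (+ 1 + N) + + 2) * a₁ - (+ 4 * N + + 2) * a₀ - a₂ ≡⟨ collect N a₀ a₁ a₂ ⟩
      + 4 * ((+ 1 + N) * (a₁ - a₀)) + + 2 * a₁ - a₂ + + 2 * a₀ ∎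
      where
      expand : ∀ N a₁ a₂ → (+ 2 + N) * (a₂ - a₁) ≡ (+ 3 + N) * a₂ - (+ 2 + N) * a₁ - a₂
      expand = solve-∀
      collect : ∀ N a₀ a₁ a₂ → (+ 4 * (+ 1 + N) + + 2) * a₁ - (+ 4 * N + + 2) * a₀ - a₂ ≡
                               + 4 * ((+ 1 + N) * (a₁ - a₀)) + + 2 * a₁ - a₂ + + 2 * a₀
      collect = solve-∀

module PowerSeries where
  open Sums
  open import Data.Nat.Base as ℕ using (_<_; _∸_; s≤s)
  open import Data.Nat.Properties using (m∸[m∸n]≡n; m∸n+n≡m)
  open import Data.Integer.Base using (ℤ; +_; -_; 0ℤ; 1ℤ; _+_; _*_; _-_)
  open import Data.Integer.Properties
    using (+-identityˡ; +-identityʳ; *-identityˡ; *-comm; *-assoc; *-zeroʳ; *-distribʳ-+; *-cancelˡ-≡; pos-+)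
  open import Data.Integer.Tactic.RingSolver using (solve-∀)
  open import Relation.Binary.PropositionalEquality using (_≗_)
  open ≡-Reasoning

  ⊛-∑ : ∀ f g n → (f ⊛ g) n ≡ ∑[ i < suc n ] (f i * g (n ∸ i))
  ⊛-∑ f g n = ∑∈-applyUpTo (λ i → i) (suc n) (λ i → f i * g (n ∸ i))

  ⊛-cong : ∀ {f f′ g g′} → f ≗ f′ → g ≗ g′ → (f ⊛ g) ≗ (f′ ⊛ g′)
  ⊛-cong {f} {f′} {g} {g′} f≗f′ g≗g′ n = begin
    (f ⊛ g) n                          ≡⟨ ⊛-∑ f g n ⟩
    ∑[ i < suc n ] (f i * g (n ∸ i))   ≡⟨ ∑-cong (suc n) (λ i _ → cong₂ _*_ (f≗f′ i) (g≗g′ (n ∸ i))) ⟩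
    ∑[ i < suc n ] (f′ i * g′ (n ∸ i)) ≡⟨ ⊛-∑ f′ g′ n ⟨
    (f′ ⊛ g′) n                        ∎

  poly-[]-⊛ : ∀ g n → (poly [] ⊛ g) n ≡ 0ℤ
  poly-[]-⊛ g n = trans (⊛-∑ (poly []) g n) (∑-zero (suc n))

  poly-∷-⊛ : ∀ c cs g n → (poly (c ∷ cs) ⊛ g) (suc n) ≡ c * g (suc n) + (poly cs ⊛ g) n
  poly-∷-⊛ c cs g n = trans (⊛-∑ (poly (c ∷ cs)) g (suc n)) (cong (_+_ (c * g (suc n))) (sym (⊛-∑ (poly cs) g n)))

  poly-[c]-⊛ : ∀ c g n → (poly [ c ] ⊛ g) n ≡ c * g n
  poly-[c]-⊛ c g zero    = +-identityʳ (c * g 0)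
  poly-[c]-⊛ c g (suc n) = trans (poly-∷-⊛ c [] g n) (trans (cong (_+_ (c * g (suc n))) (poly-[]-⊛ g n)) (+-identityʳ _))

  infixl 6 _⊞_
  infixl 7 _⊠_

  _⊞_ : List ℤ → List ℤ → List ℤ
  []       ⊞ ys       = ys
  (x ∷ xs) ⊞ []       = x ∷ xs
  (x ∷ xs) ⊞ (y ∷ ys) = x + y ∷ xs ⊞ ys

  _⊠_ : List ℤ → List ℤ → List ℤ
  []       ⊠ ys = []
  (x ∷ xs) ⊠ ys = map (x *_) ys ⊞ (0ℤ ∷ xs ⊠ ys)

  poly-⊞ : ∀ xs ys n → poly (xs ⊞ ys) n ≡ poly xs n + poly ys n
  poly-⊞ []       ys       n       = sym (+-identityˡ _)
  poly-⊞ (x ∷ xs) []       n       = sym (+-identityʳ _)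
  poly-⊞ (x ∷ xs) (y ∷ ys) zero    = refl
  poly-⊞ (x ∷ xs) (y ∷ ys) (suc n) = poly-⊞ xs ys n

  poly-map-* : ∀ c ys n → poly (map (c *_) ys) n ≡ c * poly ys n
  poly-map-* c []       n       = sym (*-zeroʳ c)
  poly-map-* c (y ∷ ys) zero    = refl
  poly-map-* c (y ∷ ys) (suc n) = poly-map-* c ys n

  poly-⊛-poly : ∀ xs ys → (poly xs ⊛ poly ys) ≗ poly (xs ⊠ ys)
  poly-⊛-poly []       ys n       = poly-[]-⊛ (poly ys) n
  poly-⊛-poly (x ∷ xs) ys zero    = begin
    x * poly ys 0 + 0ℤ                              ≡⟨ +-identityʳ _ ⟩
    x * poly ys 0                                   ≡⟨ poly-map-* x ys 0 ⟨
    poly (map (x *_) ys) 0                          ≡⟨ +-identityʳ _ ⟨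
    poly (map (x *_) ys) 0 + 0ℤ                     ≡⟨ poly-⊞ (map (x *_) ys) (0ℤ ∷ xs ⊠ ys) 0 ⟨
    poly ((x ∷ xs) ⊠ ys) 0                          ∎
  poly-⊛-poly (x ∷ xs) ys (suc n) = begin
    (poly (x ∷ xs) ⊛ poly ys) (suc n)                ≡⟨ poly-∷-⊛ x xs (poly ys) n ⟩
    x * poly ys (suc n) + (poly xs ⊛ poly ys) n      ≡⟨ cong₂ _+_ (sym (poly-map-* x ys (suc n))) (poly-⊛-poly xs ys n) ⟩
    poly (map (x *_) ys) (suc n) + poly (xs ⊠ ys) n  ≡⟨ poly-⊞ (map (x *_) ys) (0ℤ ∷ xs ⊠ ys) (suc n) ⟨
    poly ((x ∷ xs) ⊠ ys) (suc n)                     ∎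

  poly-⊛-≗ : ∀ xs ys {g} → g ≗ poly ys → (poly xs ⊛ g) ≗ poly (xs ⊠ ys)
  poly-⊛-≗ xs ys {g} g≗ n = trans (⊛-cong {f = poly xs} {g = g} (λ _ → refl) g≗ n) (poly-⊛-poly xs ys n)

  -- The hypothesis says (1 − 4z) s′ = −2s, so T = s ⊛ s satisfies (1 − 4z) T′ = −4T, that is
  -- (n + 1) Tₙ₊₁ = (4n − 4) Tₙ; T₂ = 0 then kills every later coefficient.  W n = ∑ i sᵢ sₙ₋ᵢ
  -- carries the derivative, and the symmetry i ↔ n − i of the Cauchy product gives 2 W n = n T n.
  module Square (s : Series) (s-rec : ∀ n → + suc n * s (suc n) ≡ (+ 4 * + n - + 2) * s n) where

    term : ℕ → ℕ → ℤ
    term n i = s i * s (n ∸ i)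

    T W : ℕ → ℤ
    T n = ∑[ i < suc n ] term n i
    W n = ∑[ i < suc n ] (+ i * term n i)

    W-double : ∀ n → W n + W n ≡ + n * T n
    W-double n = begin
      W n + W n
        ≡⟨ cong (_+ W n) reversed ⟨
      ∑[ i < suc n ] (+ (n ∸ i) * term n i) + W n
        ≡⟨ ∑-distrib-+ (suc n) (λ i → + (n ∸ i) * term n i) (λ i → + i * term n i) ⟨
      ∑[ i < suc n ] (+ (n ∸ i) * term n i + + i * term n i)
        ≡⟨ ∑-cong (suc n) weights ⟩
      ∑[ i < suc n ] (+ n * term n i)
        ≡⟨ *-distribˡ-∑ (suc n) (+ n) (term n) ⟨
      + n * T n
        ∎
      where
      mirror : ∀ i → i < suc n → + (n ∸ i) * term n (n ∸ i) ≡ + (n ∸ i) * term n i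
      mirror i (s≤s i≤n) = trans (cong (λ j → + (n ∸ i) * (s (n ∸ i) * s j)) (m∸[m∸n]≡n i≤n))
                                 (cong (+ (n ∸ i) *_) (*-comm (s (n ∸ i)) (s i)))
      reversed : ∑[ i < suc n ] (+ (n ∸ i) * term n i) ≡ W n
      reversed = trans (sym (∑-cong (suc n) mirror)) (∑-reverse (suc n) (λ i → + i * term n i))
      weights : ∀ i → i < suc n → + (n ∸ i) * term n i + + i * term n i ≡ + n * term n i
      weights i (s≤s i≤n) = trans (sym (*-distribʳ-+ (term n i) (+ (n ∸ i)) (+ i)))
        (cong (_* term n i) (trans (sym (pos-+ (n ∸ i) i)) (cong +_ (m∸n+n≡m i≤n))))

    W-suc : ∀ n → W (suc n) ≡ + 4 * W n - + 2 * T n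
    W-suc n = begin
      0ℤ + ∑[ i < suc n ] (+ suc i * term (suc n) (suc i))
        ≡⟨ +-identityˡ _ ⟩
      ∑[ i < suc n ] (+ suc i * term (suc n) (suc i))
        ≡⟨ ∑-cong (suc n) (λ i _ → shift i) ⟩
      ∑[ i < suc n ] (+ 4 * (+ i * term n i) + - + 2 * term n i)
        ≡⟨ ∑-distrib-+ (suc n) (λ i → + 4 * (+ i * term n i)) (λ i → - + 2 * term n i) ⟩
      ∑[ i < suc n ] (+ 4 * (+ i * term n i)) + ∑[ i < suc n ] (- + 2 * term n i)
        ≡⟨ cong₂ _+_ (*-distribˡ-∑ (suc n) (+ 4) (λ i → + i * term n i))
                     (*-distribˡ-∑ (suc n) (- + 2) (term n)) ⟨
      + 4 * W n + - + 2 * T n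
        ≡⟨ lemma (W n) (T n) ⟩
      + 4 * W n - + 2 * T n
        ∎
      where
      shift : ∀ i → + suc i * term (suc n) (suc i) ≡ + 4 * (+ i * term n i) + - + 2 * term n i
      shift i = begin
        + suc i * (s (suc i) * s (n ∸ i))        ≡⟨ *-assoc (+ suc i) (s (suc i)) (s (n ∸ i)) ⟨
        + suc i * s (suc i) * s (n ∸ i)          ≡⟨ cong (_* s (n ∸ i)) (s-rec i) ⟩
        (+ 4 * + i - + 2) * s i * s (n ∸ i)      ≡⟨ distribute (+ i) (s i) (s (n ∸ i)) ⟩
        + 4 * (+ i * term n i) + - + 2 * term n i ∎
        where
        distribute : ∀ j a b → (+ 4 * j - + 2) * a * b ≡ + 4 * (j * (a * b)) + - + 2 * (a * b)
        distribute = solve-∀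
      lemma : ∀ w t → + 4 * w + - + 2 * t ≡ + 4 * w - + 2 * t
      lemma = solve-∀

    T-suc : ∀ n → + suc n * T (suc n) ≡ (+ 4 * + n - + 4) * T n
    T-suc n = begin
      + suc n * T (suc n)                                 ≡⟨ W-double (suc n) ⟨
      W (suc n) + W (suc n)                               ≡⟨ cong₂ _+_ (W-suc n) (W-suc n) ⟩
      (+ 4 * W n - + 2 * T n) + (+ 4 * W n - + 2 * T n)   ≡⟨ lemma (W n) (T n) ⟩
      + 4 * (W n + W n) - + 4 * T n                       ≡⟨ cong (λ w → + 4 * w - + 4 * T n) (W-double n) ⟩
      + 4 * (+ n * T n) - + 4 * T n                       ≡⟨ collect (+ n) (T n) ⟩
      (+ 4 * + n - + 4) * T n                             ∎
      where
      lemma : ∀ w t → (+ 4 * w - + 2 * t) + (+ 4 * w - + 2 * t) ≡ + 4 * (w + w) - + 4 * t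
      lemma = solve-∀
      collect : ∀ n t → + 4 * (n * t) - + 4 * t ≡ (+ 4 * n - + 4) * t
      collect = solve-∀

    T-vanishes : ∀ k → T (suc (suc k)) ≡ 0ℤ
    T-vanishes zero    = *-cancelˡ-≡ (+ 2) (T 2) 0ℤ (T-suc 1)
    T-vanishes (suc k) = *-cancelˡ-≡ (+ suc (suc (suc k))) (T (3 ℕ.+ k)) 0ℤ (begin
      + suc (suc (suc k)) * T (3 ℕ.+ k)  ≡⟨ T-suc (suc (suc k)) ⟩
      c * T (suc (suc k))                ≡⟨ cong (c *_) (T-vanishes k) ⟩
      c * 0ℤ                             ≡⟨ *-zeroʳ c ⟩
      0ℤ                                 ≡⟨ *-zeroʳ (+ suc (suc (suc k))) ⟨
      + suc (suc (suc k)) * 0ℤ           ∎)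
      where c = + 4 * + suc (suc k) - + 4

  square-of-sqrt[1-4z] : ∀ s → s 0 ≡ 1ℤ → (∀ n → + suc n * s (suc n) ≡ (+ 4 * + n - + 2) * s n) →
                      ∀ n → (s ⊛ s) n ≡ oneMinus4z n
  square-of-sqrt[1-4z] s s₀ s-rec = result
    where
    open Square s s-rec using (T-vanishes)
    s₁ : s 1 ≡ - + 2
    s₁ = trans (sym (*-identityˡ (s 1))) (trans (s-rec 0) (cong (λ t → (+ 4 * + 0 - + 2) * t) s₀))
    result : ∀ n → (s ⊛ s) n ≡ oneMinus4z n
    result zero          = trans (⊛-∑ s s 0) (cong (λ t → t * t + 0ℤ) s₀)
    result (suc zero)    = trans (⊛-∑ s s 1) (cong₂ (λ a b → a * b + (b * a + 0ℤ)) s₀ s₁)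
    result (suc (suc k)) = trans (⊛-∑ s s (suc (suc k))) (T-vanishes k)


module Elimination where
  open import Data.Integer.Base using (ℤ; +_; _+_; _*_; _-_)
  open import Data.Integer.Tactic.RingSolver using (solve-∀)

  -- With E the shift, the left side is 2(E − 1)²(E − 2)(E − 4) applied to J: the factor E − 2
  -- removes D, the factors E − 1 remove G, L and R, and E − 4 removes X.
  annihilate : ∀ (J A D L G R X : ℕ → ℤ) →
    (∀ n → J n ≡ A n + D n + L n) →
    (∀ n → D (suc n) ≡ + 2 * D n + G n) →
    (∀ n → G (suc n) ≡ G n + (A (suc (suc n)) - + 2 * A (suc n))) →
    (∀ n → L (suc n) ≡ L n + R n) →
    (∀ n → R (suc n) ≡ R n + X n - + 2 * (A (suc (suc n)) - + 2 * A (suc n))) →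
    (∀ n → X (suc n) ≡ + 4 * X n + + 2 * A (suc n) - A (suc (suc n)) + + 2 * A n) →
    ∀ n → + 2 * J (suc (suc (suc (suc n)))) - + 16 * J (suc (suc (suc n))) + + 42 * J (suc (suc n))
            - + 44 * J (suc n) + + 16 * J n ≡ + 8 * A n - + 2 * A (suc (suc n))
  annihilate J A D L G R X hJ hD hG hL hR hX n
    rewrite hJ n | hJ (suc n) | hJ (suc (suc n)) | hJ (suc (suc (suc n))) | hJ (suc (suc (suc (suc n))))
          | hD (suc (suc (suc n))) | hD (suc (suc n)) | hD (suc n) | hD n
          | hG (suc (suc n)) | hG (suc n) | hG n
          | hL (suc (suc (suc n))) | hL (suc (suc n)) | hL (suc n) | hL n
          | hR (suc (suc n)) | hR (suc n) | hR n
          | hX (suc n) | hX n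
    = eliminate (A n) (A (suc n)) (A (suc (suc n))) (A (suc (suc (suc n)))) (A (suc (suc (suc (suc n)))))
                (D n) (G n) (L n) (R n) (X n)
    where
    eliminate : ∀ a₀ a₁ a₂ a₃ a₄ d₀ g₀ l₀ r₀ x₀ →
      let x₁ = + 4 * x₀ + + 2 * a₁ - a₂ + + 2 * a₀
          x₂ = + 4 * x₁ + + 2 * a₂ - a₃ + + 2 * a₁
          g₁ = g₀ + (a₂ - + 2 * a₁)
          g₂ = g₁ + (a₃ - + 2 * a₂)
          g₃ = g₂ + (a₄ - + 2 * a₃)
          r₁ = r₀ + x₀ - + 2 * (a₂ - + 2 * a₁)
          r₂ = r₁ + x₁ - + 2 * (a₃ - + 2 * a₂)
          r₃ = r₂ + x₂ - + 2 * (a₄ - + 2 * a₃)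
          d₁ = + 2 * d₀ + g₀
          d₂ = + 2 * d₁ + g₁
          d₃ = + 2 * d₂ + g₂
          d₄ = + 2 * d₃ + g₃
          l₁ = l₀ + r₀
          l₂ = l₁ + r₁
          l₃ = l₂ + r₂
          l₄ = l₃ + r₃
      in + 2 * (a₄ + d₄ + l₄) - + 16 * (a₃ + d₃ + l₃) + + 42 * (a₂ + d₂ + l₂)
           - + 44 * (a₁ + d₁ + l₁) + + 16 * (a₀ + d₀ + l₀) ≡ + 8 * a₀ - + 2 * a₂
    eliminate = solve-∀

module GeneratingFunction where
  open Recurrences
  open Catalan using (catalan-recurrence; scaledΔA-suc)
  open PowerSeries
  open Elimination
  open import Data.Integer.Base using (ℤ; +_; -_; 0ℤ; 1ℤ; _+_; _*_; _-_)
  open import Data.Integer.Tactic.RingSolver using (solve-∀)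
  open import Relation.Binary.PropositionalEquality using (_≗_)
  open ≡-Reasoning

  S : Series
  S zero    = 1ℤ
  S (suc n) = - (+ 2 * A n)

  S-recurrence : ∀ n → + suc n * S (suc n) ≡ (+ 4 * + n - + 2) * S n
  S-recurrence zero    = refl
  S-recurrence (suc n) = begin
    (+ 2 + + n) * - (+ 2 * A (suc n))   ≡⟨ lemma₁ (+ n) (A (suc n)) ⟩
    - + 2 * ((+ 2 + + n) * A (suc n))   ≡⟨ cong (λ t → - + 2 * t) (catalan-recurrence n) ⟩
    - + 2 * ((+ 4 * + n + + 2) * A n)   ≡⟨ lemma₂ (+ n) (A n) ⟩
    (+ 4 * (+ 1 + + n) - + 2) * - (+ 2 * A n) ∎
    where
    lemma₁ : ∀ n a → (+ 2 + n) * - (+ 2 * a) ≡ - + 2 * ((+ 2 + n) * a)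
    lemma₁ = solve-∀
    lemma₂ : ∀ n a → - + 2 * ((+ 4 * n + + 2) * a) ≡ (+ 4 * (+ 1 + n) - + 2) * - (+ 2 * a)
    lemma₂ = solve-∀

  S⊛S : ∀ n → (S ⊛ S) n ≡ oneMinus4z n
  S⊛S = square-of-sqrt[1-4z] S refl S-recurrence

  F-recurrence : ∀ n → + 2 * F (suc (suc (suc (suc n)))) - + 16 * F (suc (suc (suc n))) + + 42 * F (suc (suc n))
                         - + 44 * F (suc n) + + 16 * F n ≡ + 8 * A n - + 2 * A (suc (suc n))
  F-recurrence =
    annihilate F A D L gap second scaledΔA I≡A+D+L D-suc gap-suc-Δ²A L-suc second-suc-Δ²A scaledΔA-suc

  denom-coefficients : denom ≗ poly (+ 2 ∷ - + 16 ∷ + 42 ∷ - + 44 ∷ + 16 ∷ [])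
  denom-coefficients =
    poly-⊛-≗ [ + 2 ] (1-z ⊠ (1-z ⊠ (1-2z ⊠ 1-4z)))
      (poly-⊛-≗ 1-z (1-z ⊠ (1-2z ⊠ 1-4z)) (poly-⊛-≗ 1-z (1-2z ⊠ 1-4z) (poly-⊛-poly 1-2z 1-4z)))
    where
    1-z 1-2z 1-4z : List ℤ
    1-z  = + 1 ∷ - + 1 ∷ []
    1-2z = + 1 ∷ - + 2 ∷ []
    1-4z = + 1 ∷ - + 4 ∷ []

  sqrtCoeff-coefficients : sqrtCoeff ≗ poly (0ℤ ∷ 1ℤ ∷ 0ℤ ∷ - + 4 ∷ [])
  sqrtCoeff-coefficients =
    poly-⊛-≗ (0ℤ ∷ 1ℤ ∷ []) ((+ 1 ∷ - + 2 ∷ []) ⊠ (+ 1 ∷ + 2 ∷ [])) (poly-⊛-poly (+ 1 ∷ - + 2 ∷ []) (+ 1 ∷ + 2 ∷ []))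

  denom-⊛ : ∀ g n → (denom ⊛ g) (suc (suc (suc (suc n)))) ≡
    + 2 * g (suc (suc (suc (suc n)))) - + 16 * g (suc (suc (suc n))) + + 42 * g (suc (suc n)) - + 44 * g (suc n) + + 16 * g n
  denom-⊛ g n
    rewrite ⊛-cong {g = g} denom-coefficients (λ _ → refl) (suc (suc (suc (suc n))))
          | poly-∷-⊛ (+ 2) (- + 16 ∷ + 42 ∷ - + 44 ∷ + 16 ∷ []) g (suc (suc (suc n)))
          | poly-∷-⊛ (- + 16) (+ 42 ∷ - + 44 ∷ + 16 ∷ []) g (suc (suc n))
          | poly-∷-⊛ (+ 42) (- + 44 ∷ + 16 ∷ []) g (suc n)
          | poly-∷-⊛ (- + 44) (+ 16 ∷ []) g n
          | poly-[c]-⊛ (+ 16) g n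
    = lemma (g (suc (suc (suc (suc n))))) (g (suc (suc (suc n)))) (g (suc (suc n))) (g (suc n)) (g n)
    where
    lemma : ∀ g₄ g₃ g₂ g₁ g₀ → + 2 * g₄ + (- + 16 * g₃ + (+ 42 * g₂ + (- + 44 * g₁ + + 16 * g₀))) ≡
                               + 2 * g₄ - + 16 * g₃ + + 42 * g₂ - + 44 * g₁ + + 16 * g₀
    lemma = solve-∀

  sqrtCoeff-⊛ : ∀ g n → (sqrtCoeff ⊛ g) (suc (suc (suc (suc n)))) ≡ g (suc (suc (suc n))) - + 4 * g (suc n)
  sqrtCoeff-⊛ g n
    rewrite ⊛-cong {g = g} sqrtCoeff-coefficients (λ _ → refl) (suc (suc (suc (suc n))))
          | poly-∷-⊛ 0ℤ (1ℤ ∷ 0ℤ ∷ - + 4 ∷ []) g (suc (suc (suc n)))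
          | poly-∷-⊛ 1ℤ (0ℤ ∷ - + 4 ∷ []) g (suc (suc n))
          | poly-∷-⊛ 0ℤ (- + 4 ∷ []) g (suc n)
          | poly-[c]-⊛ (- + 4) g (suc n)
    = lemma (g (suc (suc (suc (suc n))))) (g (suc (suc (suc n)))) (g (suc (suc n))) (g (suc n))
    where
    lemma : ∀ g₄ g₃ g₂ g₁ → 0ℤ * g₄ + (1ℤ * g₃ + (0ℤ * g₂ + - + 4 * g₁)) ≡ g₃ - + 4 * g₁
    lemma = solve-∀

  F-equation : ∀ n → (denom ⊛ F) n ≡ (numPoly ⊕ (sqrtCoeff ⊛ S)) n
  F-equation zero                      = refl
  F-equation (suc zero)                = refl
  F-equation (suc (suc zero))          = refl
  F-equation (suc (suc (suc zero)))    = refl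
  F-equation (suc (suc (suc (suc n)))) = begin
    (denom ⊛ F) (suc (suc (suc (suc n))))
      ≡⟨ denom-⊛ F n ⟩
    + 2 * F (suc (suc (suc (suc n)))) - + 16 * F (suc (suc (suc n))) + + 42 * F (suc (suc n)) - + 44 * F (suc n) + + 16 * F n
      ≡⟨ F-recurrence n ⟩
    + 8 * A n - + 2 * A (suc (suc n))
      ≡⟨ lemma (A n) (A (suc (suc n))) ⟩
    0ℤ + (S (suc (suc (suc n))) - + 4 * S (suc n))
      ≡⟨ cong (_+_ 0ℤ) (sqrtCoeff-⊛ S n) ⟨
    (numPoly ⊕ (sqrtCoeff ⊛ S)) (suc (suc (suc (suc n))))
      ∎
    where
    lemma : ∀ a₀ a₂ → + 8 * a₀ - + 2 * a₂ ≡ 0ℤ + (- (+ 2 * a₂) - + 4 * - (+ 2 * a₀))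
    lemma = solve-∀

open GeneratingFunction using (S; S⊛S; F-equation)
open import Data.Integer.Base using (+_)

mainTheorem2 : Σ Series (λ S → (S 0 ≡ + 1) × ((∀ n → (S ⊛ S) n ≡ oneMinus4z n) × (∀ n → (denom ⊛ F) n ≡ (numPoly ⊕ (sqrtCoeff ⊛ S)) n)))
mainTheorem2 = S , refl , S⊛S , F-equation
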